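{- Let $n\ge2$, $n'\ge n$, and let $B\subseteq2^{[n]}$ be a semi-normal TP-basis. Then $B^\Delta$ belongs to $\mathcal B_{n+n'}^n$, the set of TP-bases for $\Delta_{n+n'}^n$ obtainable from $\mathcal{IS}_{n+n'}^n$ by finite sequences of 4-flips.
   Context: Notation: $[N]=\{1,\dots,N\}$, $[p..q]=\{p,\dots,q\}$; $Xi=X\cup\{i\}$ etc. $\Delta_N^m=\{S\subseteq[N]:|S|=m\}$. Boolean TP-bases. $f:2^{[n]}\to\mathbb R$ is a TP-function if $f(Xik)+f(Xj)=\max\{f(Xij)+f(Xk),f(Xi)+f(Xjk)\}$ for all $i<j<k$, $X\subseteq[n]\setminus\{i,j,k\}$. $B\subseteq2^{[n]}$ is a TP-basis if restriction from TP-functions to $\mathbb R^B$ is bijective. $\mathcal I_n$ ($\emptyset$ and all intervals $[p..q]$) is a TP-basis. A flip: if a TP-basis contains $Xij,Xk,Xi,Xjk$ ($i<j<k$) and exactly one $Y\in\{Xj,Xik\}$, replace $Y$ by the other member. Semi-normal TP-bases: those obtained from $\mathcal I_n$ by finitely many flips. Hyper-simplex TP-bases. $f:\Delta_N^m\to\mathbb R$ is a TP-function if $f(Xik)+f(Xj\ell)=\max\{f(Xij)+f(Xk\ell),f(Xi\ell)+f(Xjk)\}$ for all $i<j<k<\ell$ in $[N]$ and $X\subseteq[N]\setminus\{i,j,k,\ell\}$ with $|X|=m-2$; TP-bases defined via bijectivity of restriction. $\mathcal{IS}_N^m$ = all $m$-element intervals of $[N]$ together with all $m$-element sets $[1..p]\cup[q..r]$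 with $p\ge1$, $q\le r$, $q>p+1$. A 4-flip: if a TP-basis contains $Xij,Xk\ell,Xi\ell,Xjk$ and exactly one $Y\in\{Xik,Xj\ell\}$, replace $Y$ by the other member (again a TP-basis). The map $B\mapsto B^\Delta$: for $X\subseteq[n]$, let $X^\Delta=X\cup[n+n'-(n-|X|)+1..n+n']$ (the union of $X$ with the interval of size $n-|X|$ ending at $n+n'$, empty if $X=[n]$). Let $\mathcal A$ be the collection of all $n$-element intervals $[p..q]\subseteq[n+n']$ with $n<q<n+n'$, together with all $n$-element sets $[p..q]\cup[r..n+n']$ with $1\le p\le q$, $n<q$, $q+1<r\le n+n'$. For $B\subseteq2^{[n]}$, $B^\Delta=\mathcal A\cup\{X^\Delta:X\in B\}$. -}

module Defs where

open import Data.Bool using (Bool; true; false; _∧_)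
open import Data.Nat as ℕ using (ℕ; _+_; _∸_; _≤ᵇ_)
import Data.Nat as N
open import Data.Fin as F using (Fin; toℕ)
open import Data.Fin.Subset as S using (Subset; ⁅_⁆; _∪_; ∣_∣; _∈_; _∉_)
open import Data.Vec using (tabulate; _++_; replicate)
open import Data.Product using (Σ; ∃; ∃-syntax; _×_)
open import Data.Sum using (_⊎_)
open import Relation.Nullary using (¬_)
open import Relation.Binary.PropositionalEquality using (_≡_; _≢_)
open import Function.Bundles using (_⇔_)

-- Convention: an element x : Fin N stands for the number toℕ x + 1 ∈ [N].

Coll : ℕ → Set₁
Coll N = Subset N → Set

_≐_ : ∀ {N} → Coll N → Coll N → Set
B ≐ C = ∀ Y → B Y ⇔ C Y

-- The interval [p..q] ⊆ [N] (1-based; empty if p > q).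
⟦_‥_⟧ : ∀ {N} → ℕ → ℕ → Subset N
⟦ p ‥ q ⟧ = tabulate (λ x → (p ≤ᵇ N.suc (toℕ x)) ∧ (N.suc (toℕ x) ≤ᵇ q))

ExactlyOne : Set → Set → Set
ExactlyOne P Q = (P × ¬ Q) ⊎ (¬ P × Q)

SwapAt : ∀ {N} → Subset N → Subset N → Coll N → Coll N → Set
SwapAt U V B B' =
  ExactlyOne (B U) (B V) ×
  (∀ Y → (Y ≡ U → (B' Y ⇔ B V)) ×
         (Y ≡ V → (B' Y ⇔ B U)) ×
         (Y ≢ U → Y ≢ V → (B' Y ⇔ B Y)))

data Reach {N : ℕ} (R : Coll N → Coll N → Set) (start : Coll N) : Coll N → Set₁ where
  base : ∀ {B} → B ≐ start → Reach R start B
  step : ∀ {B B'} → Reach R start B → R B B' → Reach R start B'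

𝓘 : (n : ℕ) → Coll n
𝓘 n Y = (Y ≡ S.⊥) ⊎ (∃[ p ] ∃[ q ] (1 N.≤ p × p N.≤ q × q N.≤ n × Y ≡ ⟦ p ‥ q ⟧))

Flip : ∀ {n} → Coll n → Coll n → Set
Flip {n} B B' = Σ (Fin n) λ i → Σ (Fin n) λ j → Σ (Fin n) λ k → Σ (Subset n) λ X →
  i F.< j × j F.< k × i ∉ X × j ∉ X × k ∉ X ×
  B (X ∪ ⁅ i ⁆ ∪ ⁅ j ⁆) × B (X ∪ ⁅ k ⁆) × B (X ∪ ⁅ i ⁆) × B (X ∪ ⁅ j ⁆ ∪ ⁅ k ⁆) ×
  SwapAt (X ∪ ⁅ j ⁆) (X ∪ ⁅ i ⁆ ∪ ⁅ k ⁆) B B'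

SemiNormal : (n : ℕ) → Coll n → Set₁
SemiNormal n B = Reach Flip (𝓘 n) B

𝓘𝓢 : (N m : ℕ) → Coll N
𝓘𝓢 N m Y =
  (∃[ p ] ∃[ q ] (1 N.≤ p × p N.≤ q × q N.≤ N × Y ≡ ⟦ p ‥ q ⟧ × ∣ Y ∣ ≡ m)) ⊎
  (∃[ p ] ∃[ q ] ∃[ r ] (1 N.≤ p × q N.≤ r × p + 1 N.< q × r N.≤ N ×
        Y ≡ ⟦ 1 ‥ p ⟧ ∪ ⟦ q ‥ r ⟧ × ∣ Y ∣ ≡ m))

Flip4 : ∀ {N} → ℕ → Coll N → Coll N → Set
Flip4 {N} m B B' = Σ (Fin N) λ i → Σ (Fin N) λ j → Σ (Fin N) λ k → Σ (Fin N) λ l → Σ (Subset N) λ X →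
  i F.< j × j F.< k × k F.< l × i ∉ X × j ∉ X × k ∉ X × l ∉ X × ∣ X ∣ + 2 ≡ m ×
  B (X ∪ ⁅ i ⁆ ∪ ⁅ j ⁆) × B (X ∪ ⁅ k ⁆ ∪ ⁅ l ⁆) × B (X ∪ ⁅ i ⁆ ∪ ⁅ l ⁆) × B (X ∪ ⁅ j ⁆ ∪ ⁅ k ⁆) ×
  SwapAt (X ∪ ⁅ i ⁆ ∪ ⁅ k ⁆) (X ∪ ⁅ j ⁆ ∪ ⁅ l ⁆) B B'

InB : (N m : ℕ) → Coll N → Set₁
InB N m B = Reach (Flip4 m) (𝓘𝓢 N m) B

_^Δ : ∀ {n n'} → Subset n → Subset (n + n')
_^Δ {n} {n'} X = (X ++ replicate n' false) ∪ ⟦ n + n' ∸ (n ∸ ∣ X ∣) + 1 ‥ n + n' ⟧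

𝓐 : (n n' : ℕ) → Coll (n + n')
𝓐 n n' Y =
  (∃[ p ] ∃[ q ] (1 N.≤ p × p N.≤ q × n N.< q × q N.< n + n' × Y ≡ ⟦ p ‥ q ⟧ × ∣ Y ∣ ≡ n)) ⊎
  (∃[ p ] ∃[ q ] ∃[ r ] (1 N.≤ p × p N.≤ q × n N.< q × q + 1 N.< r × r N.≤ n + n' ×
        Y ≡ ⟦ p ‥ q ⟧ ∪ ⟦ r ‥ n + n' ⟧ × ∣ Y ∣ ≡ n))

_Δ : ∀ {n} → Coll n → (n' : ℕ) → Coll (n + n')
_Δ {n} B n' Y = 𝓐 n n' Y ⊎ (∃[ X ] (B X × Y ≡ _^Δ {n} {n'} X))

-- B ↦ B^Δ turns every Boolean flip into a 4-flip: for a flip at i < j < k on X, the sets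
-- (Xij)^Δ, (Xk)^Δ, (Xi)^Δ, (Xjk)^Δ, (Xj)^Δ, (Xik)^Δ are X⁺ij, X⁺kℓ, X⁺iℓ, X⁺jk, X⁺jℓ, X⁺ik for
-- the point ℓ just below the tail of (Xij)^Δ and a suitable X⁺, and no X^Δ lies in 𝓐.  So it
-- suffices to reach 𝓘_n^Δ from 𝓘𝓢_N^n, N = n + n'.  Both consist of all n-intervals and, for each
-- shape (s, g) with 0 < s < n and 0 < g ≤ N − n, one set [P, P + s) ∪ [P + s + g, P + n + g): at P = 0
-- in 𝓘𝓢, at the rightmost position P = N − n − g in 𝓘_n^Δ.  The 4-flip at
-- P < P + s < P + s + g < P + n + g moves such a set one step right when its lexicographic
-- neighbours among the shapes are suitably placed, so repeated sweeps through the shapes in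
-- lexicographic order carry every set to the right end.

module Submission where

open import Defs
open import Data.Nat using (ℕ; _≤_; _+_; zero; suc; pred; _∸_; _<_; z≤n; s≤s; _⊓_; _<?_; _≤?_; _≟_)

import Algebra.Solver.CommutativeMonoid as CommutativeMonoidSolver
open import Data.Bool using (Bool; true; false; _∧_; _∨_; if_then_else_)
open import Data.Bool.Properties using (∨-zeroʳ; ∨-identityʳ; ∧-zeroʳ)
open import Data.Empty using (⊥-elim)
open import Data.Fin as F using (Fin; toℕ; _↑ˡ_)
open import Data.Fin.Properties using (toℕ-fromℕ<; toℕ-↑ˡ; toℕ<n)
open import Data.Fin.Subset as S using (Subset; ⁅_⁆; _∪_; ∣_∣; _∉_)
open import Data.Fin.Subset.Properties
  using (∪-identityˡ; ∪-identityʳ; ∪-assoc; ∪-commutativeMonoid; ∣p∣≤n; ∣⁅x⁆∣≡1; ∣⊥∣≡0)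
open import Data.Nat.Properties
open import Data.Nat.Tactic.RingSolver using (solve-∀)
open import Data.Product using (∃-syntax; _×_; _,_; proj₁; proj₂)
open import Data.Sum using (_⊎_; inj₁; inj₂)
open import Data.Vec using ([]; _∷_; lookup; _++_; replicate)
open import Data.Vec.Properties using ([]=⇒lookup; lookup⇒[]=)
open import Function.Bundles using (_⇔_; mk⇔; Equivalence)
import Function.Properties.Equivalence as ⇔
open import Relation.Binary using (tri<; tri≈; tri>)
open import Relation.Binary.PropositionalEquality
  using (_≡_; _≢_; refl; sym; trans; cong; cong₂; subst; subst₂; module ≡-Reasoning)
open import Relation.Nullary using (¬_; yes; no; does)
open import Relation.Nullary.Decidable using (dec-true; dec-false; _×-dec_)

true≢false : true ≢ false
true≢false ()

-- Points of [N] are handled 0-based: bit Y y is the membership of the point y in Y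
-- (false beyond N), and block N a l = {a, …, a + l − 1}.
bit : ∀ {N} → Subset N → ℕ → Bool
bit [] y = false
bit (b ∷ Y) zero = b
bit (b ∷ Y) (suc y) = bit Y y

block : ∀ N → ℕ → ℕ → Subset N
block zero a l = []
block (suc N) (suc a) l = false ∷ block N a l
block (suc N) zero zero = false ∷ block N zero zero
block (suc N) zero (suc l) = true ∷ block N zero l

bit-∪ : ∀ {N} (A B : Subset N) y → bit (A ∪ B) y ≡ (bit A y ∨ bit B y)
bit-∪ [] [] y = refl
bit-∪ (a ∷ A) (b ∷ B) zero = refl
bit-∪ (a ∷ A) (b ∷ B) (suc y) = bit-∪ A B y

cong-bit : ∀ {N} {A B : Subset N} y → A ≡ B → bit A y ≡ bit B y
cong-bit y e = cong (λ Z → bit Z y) e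

bit-∪-false : ∀ {N} (A B : Subset N) y → bit A y ≡ false → bit B y ≡ false → bit (A ∪ B) y ≡ false
bit-∪-false A B y a b = trans (bit-∪ A B y) (cong₂ _∨_ a b)

bit-⊥ : ∀ {N} y → bit (S.⊥ {N}) y ≡ false
bit-⊥ {zero} y = refl
bit-⊥ {suc N} zero = refl
bit-⊥ {suc N} (suc y) = bit-⊥ {N} y

lookup≡bit : ∀ {N} (Y : Subset N) (i : Fin N) → lookup Y i ≡ bit Y (toℕ i)
lookup≡bit (b ∷ Y) F.zero = refl
lookup≡bit (b ∷ Y) (F.suc i) = lookup≡bit Y i

bit-beyond : ∀ {N} (Y : Subset N) y → N ≤ y → bit Y y ≡ false
bit-beyond [] y _ = refl
bit-beyond (b ∷ Y) (suc y) (s≤s p) = bit-beyond Y y p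

bit-false⇒∉ : ∀ {N} {Y : Subset N} (i : Fin N) → bit Y (toℕ i) ≡ false → i ∉ Y
bit-false⇒∉ {Y = Y} i e i∈Y = true≢false (trans (sym ([]=⇒lookup i∈Y)) (trans (lookup≡bit Y i) e))

∉⇒bit-false : ∀ {N} (Y : Subset N) i → i ∉ Y → bit Y (toℕ i) ≡ false
∉⇒bit-false Y i i∉Y with lookup Y i in eq
... | true = ⊥-elim (i∉Y (lookup⇒[]= i Y eq))
... | false = trans (sym (lookup≡bit Y i)) eq

bit-ext : ∀ {N} (Y Z : Subset N) → (∀ y → y < N → bit Y y ≡ bit Z y) → Y ≡ Z
bit-ext [] [] h = refl
bit-ext (a ∷ Y) (b ∷ Z) h = cong₂ _∷_ (h 0 (s≤s z≤n)) (bit-ext Y Z (λ y p → h (suc y) (s≤s p)))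

bit-block-inside : ∀ N a l y → a ≤ y → y < a + l → y < N → bit (block N a l) y ≡ true
bit-block-inside (suc N) (suc a) l (suc y) (s≤s p) (s≤s q) (s≤s r) = bit-block-inside N a l y p q r
bit-block-inside (suc N) zero (suc l) zero p q r = refl
bit-block-inside (suc N) zero (suc l) (suc y) p (s≤s q) (s≤s r) = bit-block-inside N zero l y z≤n q r
bit-block-inside (suc N) zero zero y p q r = ⊥-elim (n≮0 q)

bit-block-below : ∀ N a l y → y < a → bit (block N a l) y ≡ false
bit-block-below zero a l y p = refl
bit-block-below (suc N) (suc a) l zero p = refl
bit-block-below (suc N) (suc a) l (suc y) (s≤s p) = bit-block-below N a l y p

bit-block-above : ∀ N a l y → a + l ≤ y → bit (block N a l) y ≡ false
bit-block-above zero a l y p = refl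
bit-block-above (suc N) (suc a) l (suc y) (s≤s p) = bit-block-above N a l y p
bit-block-above (suc N) zero zero zero p = refl
bit-block-above (suc N) zero zero (suc y) p = bit-block-above N zero zero y z≤n
bit-block-above (suc N) zero (suc l) (suc y) (s≤s p) = bit-block-above N zero l y p

block-empty : ∀ N a → block N a 0 ≡ S.⊥
block-empty zero a = refl
block-empty (suc N) zero = cong (false ∷_) (block-empty N zero)
block-empty (suc N) (suc a) = cong (false ∷_) (block-empty N a)

block-++ : ∀ N a l l' → block N a l ∪ block N (a + l) l' ≡ block N a (l + l')
block-++ zero a l l' = refl
block-++ (suc N) (suc a) l l' = cong (false ∷_) (block-++ N a l l')
block-++ (suc N) zero (suc l) l' = cong (true ∷_) (block-++ N zero l l')
block-++ (suc N) zero zero l' =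
  trans (cong (_∪ block (suc N) zero l') (block-empty (suc N) zero)) (∪-identityˡ _)

block-adjacent : ∀ {N a l b l' c} → a + l ≡ b → l + l' ≡ c → block N a l ∪ block N b l' ≡ block N a c
block-adjacent {N} {a} {l} {b} {l'} e₁ e₂ =
  trans (cong (λ z → block N a l ∪ block N z l') (sym e₁)) (trans (block-++ N a l l') (cong (block N a) e₂))

∣block∣ : ∀ N a l → a + l ≤ N → ∣ block N a l ∣ ≡ l
∣block∣ zero zero zero p = refl
∣block∣ (suc N) (suc a) l (s≤s p) = ∣block∣ N a l p
∣block∣ (suc N) zero (suc l) (s≤s p) = cong suc (∣block∣ N zero l p)
∣block∣ (suc N) zero zero p = ∣block∣ N zero zero z≤n

⁅⁆≡block : ∀ {N} (i : Fin N) → ⁅ i ⁆ ≡ block N (toℕ i) 1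
⁅⁆≡block {suc N} F.zero = cong (true ∷_) (sym (block-empty N zero))
⁅⁆≡block {suc N} (F.suc i) = cong (false ∷_) (⁅⁆≡block i)

bit-⁅⁆-≢ : ∀ {N} (i : Fin N) y → y ≢ toℕ i → bit ⁅ i ⁆ y ≡ false
bit-⁅⁆-≢ {N} i y y≢i with <-cmp y (toℕ i)
... | tri< p _ _ = trans (cong (λ Z → bit Z y) (⁅⁆≡block i)) (bit-block-below N (toℕ i) 1 y p)
... | tri≈ _ p _ = ⊥-elim (y≢i p)
... | tri> _ _ p = trans (cong (λ Z → bit Z y) (⁅⁆≡block i)) (bit-block-above N (toℕ i) 1 y (subst (_≤ y) (+-comm 1 (toℕ i)) p))

Disjoint : ∀ {N} → Subset N → Subset N → Set
Disjoint A B = ∀ y → (bit A y ∧ bit B y) ≡ false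

∣∪∣-disjoint : ∀ {N} (A B : Subset N) → Disjoint A B → ∣ A ∪ B ∣ ≡ ∣ A ∣ + ∣ B ∣
∣∪∣-disjoint [] [] h = refl
∣∪∣-disjoint (false ∷ A) (false ∷ B) h = ∣∪∣-disjoint A B (λ y → h (suc y))
∣∪∣-disjoint (false ∷ A) (true ∷ B) h = trans (cong suc (∣∪∣-disjoint A B (λ y → h (suc y)))) (sym (+-suc _ _))
∣∪∣-disjoint (true ∷ A) (false ∷ B) h = cong suc (∣∪∣-disjoint A B (λ y → h (suc y)))
∣∪∣-disjoint (true ∷ A) (true ∷ B) h with h 0
... | ()

∣∪⁅⁆∣ : ∀ {N} (Y : Subset N) i → bit Y (toℕ i) ≡ false → ∣ Y ∪ ⁅ i ⁆ ∣ ≡ ∣ Y ∣ + 1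
∣∪⁅⁆∣ Y i e = trans (∣∪∣-disjoint Y ⁅ i ⁆ disjoint) (cong (∣ Y ∣ +_) (∣⁅x⁆∣≡1 i))
  where
  disjoint : Disjoint Y ⁅ i ⁆
  disjoint y with y ≟ toℕ i
  ... | yes refl = cong (_∧ bit ⁅ i ⁆ y) e
  ... | no y≢i = trans (cong (bit Y y ∧_) (bit-⁅⁆-≢ i y y≢i)) (∧-zeroʳ _)

∣∪⁅⁆∪⁅⁆∣ : ∀ {N} (X : Subset N) i j → i ∉ X → j ∉ X → toℕ i ≢ toℕ j → ∣ X ∪ ⁅ i ⁆ ∪ ⁅ j ⁆ ∣ ≡ ∣ X ∣ + 2
∣∪⁅⁆∪⁅⁆∣ X i j i∉X j∉X i≢j =
  trans (cong ∣_∣ (sym (∪-assoc X ⁅ i ⁆ ⁅ j ⁆)))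
    (trans (∣∪⁅⁆∣ (X ∪ ⁅ i ⁆) j (bit-∪-false X ⁅ i ⁆ (toℕ j) (∉⇒bit-false X j j∉X) (bit-⁅⁆-≢ i (toℕ j) (λ e → i≢j (sym e)))))
      (trans (cong (_+ 1) (∣∪⁅⁆∣ X i (∉⇒bit-false X i i∉X))) (+-assoc ∣ X ∣ 1 1)))

blocks-disjoint : ∀ N a l b l' → a + l ≤ b → Disjoint (block N a l) (block N b l')
blocks-disjoint N a l b l' le y with <-cmp y b
... | tri< p _ _ = trans (cong (bit (block N a l) y ∧_) (bit-block-below N b l' y p)) (∧-zeroʳ _)
... | tri≈ _ p _ = cong (_∧ bit (block N b l') y) (bit-block-above N a l y (≤-trans le (≤-reflexive (sym p))))
... | tri> _ _ p = cong (_∧ bit (block N b l') y) (bit-block-above N a l y (≤-trans le (<⇒≤ p)))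

∣block∪block∣ : ∀ N a l b l' → a + l ≤ b → b + l' ≤ N → ∣ block N a l ∪ block N b l' ∣ ≡ l + l'
∣block∪block∣ N a l b l' p q = trans (∣∪∣-disjoint (block N a l) (block N b l') (blocks-disjoint N a l b l' p))
  (cong₂ _+_ (∣block∣ N a l (≤-trans p (≤-trans (m≤m+n b l') q))) (∣block∣ N b l' q))

⟦1‥0⟧≡⊥ : ∀ N → ⟦_‥_⟧ {N} 1 0 ≡ S.⊥
⟦1‥0⟧≡⊥ zero = refl
⟦1‥0⟧≡⊥ (suc N) = cong (false ∷_) (⟦1‥0⟧≡⊥ N)

⟦⟧≡block : ∀ N a l → ⟦_‥_⟧ {N} (suc a) (a + l) ≡ block N a l
⟦⟧≡block zero a l = refl
⟦⟧≡block (suc N) (suc a) l = cong (false ∷_) (⟦⟧≡block N a l)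
⟦⟧≡block (suc N) zero zero = cong (false ∷_) (trans (⟦1‥0⟧≡⊥ N) (sym (block-empty N zero)))
⟦⟧≡block (suc N) zero (suc l) = cong (true ∷_) (⟦⟧≡block N zero l)

⟦⟧≡block′ : ∀ N p q → 1 ≤ p → p ≤ suc q → ⟦_‥_⟧ {N} p q ≡ block N (pred p) (suc q ∸ p)
⟦⟧≡block′ N (suc a) q (s≤s _) (s≤s a≤q) =
  trans (cong (⟦_‥_⟧ (suc a)) (sym (m+[n∸m]≡n a≤q))) (⟦⟧≡block N a (q ∸ a))

fromℕ<-∉ : ∀ {N} {Y : Subset N} y (p : y < N) → bit Y y ≡ false → F.fromℕ< p ∉ Y
fromℕ<-∉ {Y = Y} y p e = bit-false⇒∉ (F.fromℕ< p) (subst (λ z → bit Y z ≡ false) (sym (toℕ-fromℕ< p)) e)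

⁅fromℕ<⁆≡block : ∀ {N} y (p : y < N) → ⁅ F.fromℕ< p ⁆ ≡ block N y 1
⁅fromℕ<⁆≡block {N} y p = trans (⁅⁆≡block (F.fromℕ< p)) (cong (λ z → block N z 1) (toℕ-fromℕ< p))

fromℕ<-mono : ∀ {N y z} (p : y < N) (q : z < N) → y < z → F.fromℕ< p F.< F.fromℕ< q
fromℕ<-mono p q = subst₂ _<_ (sym (toℕ-fromℕ< p)) (sym (toℕ-fromℕ< q))

bit-⟦⟧-last : ∀ N a q → a ≤ q → q < N → bit (⟦_‥_⟧ {N} (suc a) (suc q)) q ≡ true
bit-⟦⟧-last N a q a≤q q<N =
  trans (cong-bit q (⟦⟧≡block′ N (suc a) (suc q) (s≤s z≤n) (s≤s (≤-trans a≤q (n≤1+n q)))))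
        (bit-block-inside N a (suc q ∸ a) q a≤q (subst (q <_) (sym (m+[n∸m]≡n (≤-trans a≤q (n≤1+n q)))) (n<1+n q)) q<N)

bit-⟦⟧-after : ∀ N a q → a ≤ q → bit (⟦_‥_⟧ {N} (suc a) (suc q)) (suc q) ≡ false
bit-⟦⟧-after N a q a≤q =
  trans (cong-bit (suc q) (⟦⟧≡block′ N (suc a) (suc q) (s≤s z≤n) (s≤s (≤-trans a≤q (n≤1+n q)))))
        (bit-block-above N a (suc q ∸ a) (suc q) (≤-reflexive (m+[n∸m]≡n (≤-trans a≤q (n≤1+n q)))))

≐-sym : ∀ {N} {B C : Coll N} → B ≐ C → C ≐ B
≐-sym e Y = ⇔.sym (e Y)

≐-trans : ∀ {N} {A B C : Coll N} → A ≐ B → B ≐ C → A ≐ C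
≐-trans e f Y = ⇔.trans (e Y) (f Y)

SwapAt-≐ : ∀ {N} {U V : Subset N} {B B' C : Coll N} → SwapAt U V B B' → B' ≐ C → SwapAt U V B C
SwapAt-≐ (one , swap) e = one , λ Y → (λ Y≡U → ⇔.trans (≐-sym e Y) (proj₁ (swap Y) Y≡U))
                                   , (λ Y≡V → ⇔.trans (≐-sym e Y) (proj₁ (proj₂ (swap Y)) Y≡V))
                                   , (λ Y≢U Y≢V → ⇔.trans (≐-sym e Y) (proj₂ (proj₂ (swap Y)) Y≢U Y≢V))

Flip4-≐ : ∀ {N m} {B B' C : Coll N} → Flip4 m B B' → B' ≐ C → Flip4 m B C
Flip4-≐ (i , j , k , l , X , a₁ , a₂ , a₃ , a₄ , a₅ , a₆ , a₇ , a₈ , a₉ , a₁₀ , a₁₁ , a₁₂ , swap) e =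
  i , j , k , l , X , a₁ , a₂ , a₃ , a₄ , a₅ , a₆ , a₇ , a₈ , a₉ , a₁₀ , a₁₁ , a₁₂ , SwapAt-≐ swap e

Reach-≐ : ∀ {N m} {S B C : Coll N} → Reach (Flip4 m) S B → B ≐ C → Reach (Flip4 m) S C
Reach-≐ (base e) f = base (≐-trans (≐-sym f) e)
Reach-≐ (step r x) f = step r (Flip4-≐ x f)

Reach-trans : ∀ {N m} {A B C : Coll N} → Reach (Flip4 m) A B → Reach (Flip4 m) B C → Reach (Flip4 m) A C
Reach-trans r (base C≐B) = Reach-≐ r (≐-sym C≐B)
Reach-trans r (step r' f) = step (Reach-trans r r') f

module TwoBlocks (N m : ℕ) where

  twoBlock : ℕ → ℕ → ℕ → Subset N
  twoBlock s g P = block N P s ∪ block N (P + s + g) (m ∸ s)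

  Fits : ℕ → ℕ → ℕ → Set
  Fits s g P = 1 ≤ s × s < m × 1 ≤ g × P + m + g ≤ N

  Intervals : Coll N
  Intervals Y = ∃[ a ] (a + m ≤ N × Y ≡ block N a m)

  -- h s g is the position of the two-block set of shape (s, g).
  Layout : (ℕ → ℕ → ℕ) → Coll N
  Layout h Y = Intervals Y ⊎ ∃[ s ] ∃[ g ] ∃[ P ] (Fits s g P × Y ≡ twoBlock s g P × P ≡ h s g)

  twoBlock-end : ∀ s g P → s ≤ m → P + s + g + (m ∸ s) ≡ P + m + g
  twoBlock-end s g P s≤m = trans (shuffle P s g (m ∸ s)) (cong (λ z → P + z + g) (m+[n∸m]≡n s≤m))
    where
    shuffle : ∀ P s g t → P + s + g + t ≡ P + (s + t) + g
    shuffle = solve-∀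

  bit-twoBlock : ∀ s g P y → bit (twoBlock s g P) y ≡ (bit (block N P s) y ∨ bit (block N (P + s + g) (m ∸ s)) y)
  bit-twoBlock s g P y = bit-∪ (block N P s) (block N (P + s + g) (m ∸ s)) y

  gap<end : ∀ {s g P} → Fits s g P → P + s + g < P + m + g
  gap<end {g = g} {P} (_ , s<m , _) = +-monoˡ-< g (+-monoʳ-< P s<m)

  bit-twoBlock-left : ∀ {s g P} y → Fits s g P → P ≤ y → y < P + s → bit (twoBlock s g P) y ≡ true
  bit-twoBlock-left {s} {g} {P} y v@(_ , _ , _ , fits) P≤y y<P+s =
    trans (bit-twoBlock s g P y) (cong (_∨ bit (block N (P + s + g) (m ∸ s)) y) (bit-block-inside N P s y P≤y y<P+s y<N))
    where
    y<N : y < N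
    y<N = <-≤-trans y<P+s (≤-trans (m≤m+n (P + s) g) (≤-trans (<⇒≤ (gap<end v)) fits))

  bit-twoBlock-right : ∀ {s g P} y → Fits s g P → P + s + g ≤ y → y < P + m + g → bit (twoBlock s g P) y ≡ true
  bit-twoBlock-right {s} {g} {P} y (_ , s<m , _ , fits) gap≤y y<end =
    trans (bit-twoBlock s g P y)
      (trans (cong (bit (block N P s) y ∨_)
        (bit-block-inside N (P + s + g) (m ∸ s) y gap≤y (subst (y <_) (sym (twoBlock-end s g P (<⇒≤ s<m))) y<end)
          (<-≤-trans y<end fits)))
        (∨-zeroʳ _))

  Outside : ℕ → ℕ → ℕ → ℕ → Set
  Outside s g P y = y < P ⊎ (P + s ≤ y × y < P + s + g) ⊎ P + m + g ≤ y

  bit-twoBlock-outside : ∀ {s g P} y → Fits s g P → Outside s g P y → bit (twoBlock s g P) y ≡ false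
  bit-twoBlock-outside {s} {g} {P} y (_ , s<m , _ , _) out = trans (bit-twoBlock s g P y) (cong₂ _∨_ (left out) (right out))
    where
    end≡ : P + s + g + (m ∸ s) ≡ P + m + g
    end≡ = twoBlock-end s g P (<⇒≤ s<m)
    left : Outside s g P y → bit (block N P s) y ≡ false
    left (inj₁ y<P) = bit-block-below N P s y y<P
    left (inj₂ (inj₁ (P+s≤y , _))) = bit-block-above N P s y P+s≤y
    left (inj₂ (inj₂ end≤y)) = bit-block-above N P s y
      (≤-trans (m≤m+n (P + s) g) (≤-trans (m≤m+n (P + s + g) (m ∸ s)) (≤-trans (≤-reflexive end≡) end≤y)))
    right : Outside s g P y → bit (block N (P + s + g) (m ∸ s)) y ≡ false
    right (inj₁ y<P) = bit-block-below N _ _ y (<-≤-trans y<P (≤-trans (m≤m+n P s) (m≤m+n (P + s) g)))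
    right (inj₂ (inj₁ (_ , y<gap))) = bit-block-below N _ _ y y<gap
    right (inj₂ (inj₂ end≤y)) = bit-block-above N _ _ y (subst (_≤ y) (sym end≡) end≤y)

  twoBlock≢block : ∀ {s g P a l} → Fits s g P → twoBlock s g P ≢ block N a l
  twoBlock≢block {s} {g} {P} {a} {l} v@(1≤s , _ , 1≤g , fits) e =
    true≢false (sym (trans (sym gap-out) (trans (cong-bit (P + s) e) gap-in)))
    where
    P-in : bit (block N a l) P ≡ true
    P-in = trans (sym (cong-bit P e)) (bit-twoBlock-left P v ≤-refl (m<m+n P 1≤s))
    right-in : bit (block N a l) (P + s + g) ≡ true
    right-in = trans (sym (cong-bit _ e)) (bit-twoBlock-right _ v ≤-refl (gap<end v))
    a≤P : a ≤ P
    a≤P = ≮⇒≥ (λ P<a → true≢false (trans (sym P-in) (bit-block-below N a l P P<a)))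
    right<a+l : P + s + g < a + l
    right<a+l = ≰⇒> (λ a+l≤ → true≢false (trans (sym right-in) (bit-block-above N a l _ a+l≤)))
    gap-out : bit (twoBlock s g P) (P + s) ≡ false
    gap-out = bit-twoBlock-outside (P + s) v (inj₂ (inj₁ (≤-refl , m<m+n (P + s) 1≤g)))
    gap-in : bit (block N a l) (P + s) ≡ true
    gap-in = bit-block-inside N a l (P + s) (≤-trans a≤P (m≤m+n P s)) (≤-<-trans (m≤m+n (P + s) g) right<a+l)
               (<-≤-trans (<-trans (m<m+n (P + s) 1≤g) (gap<end v)) fits)

  twoBlock-≮-position : ∀ {s g P s' g' P'} → Fits s g P → Fits s' g' P' → twoBlock s g P ≡ twoBlock s' g' P' → ¬ (P < P')
  twoBlock-≮-position {P = P} v v' e P<P' =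
    true≢false (trans (sym (bit-twoBlock-left P v ≤-refl (m<m+n P (proj₁ v))))
      (trans (cong-bit P e) (bit-twoBlock-outside P v' (inj₁ P<P'))))

  twoBlock-≮-left : ∀ {s g P s' g'} → Fits s g P → Fits s' g' P → twoBlock s g P ≡ twoBlock s' g' P → ¬ (s < s')
  twoBlock-≮-left {s} {P = P} v@(_ , _ , 1≤g , _) v' e s<s' =
    true≢false (sym (trans (sym (bit-twoBlock-outside (P + s) v (inj₂ (inj₁ (≤-refl , m<m+n (P + s) 1≤g)))))
      (trans (cong-bit (P + s) e) (bit-twoBlock-left (P + s) v' (m≤m+n P s) (+-monoʳ-< P s<s')))))

  twoBlock-≮-gap : ∀ {s g P g'} → Fits s g P → Fits s g' P → twoBlock s g P ≡ twoBlock s g' P → ¬ (g < g')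
  twoBlock-≮-gap {s} {g} {P} v v' e g<g' =
    true≢false (trans (sym (bit-twoBlock-right (P + s + g) v ≤-refl (gap<end v)))
      (trans (cong-bit (P + s + g) e)
        (bit-twoBlock-outside (P + s + g) v' (inj₂ (inj₁ (m≤m+n (P + s) g , +-monoʳ-< (P + s) g<g'))))))

  twoBlock-injective : ∀ {s g P s' g' P'} → Fits s g P → Fits s' g' P' → twoBlock s g P ≡ twoBlock s' g' P' →
                       s ≡ s' × g ≡ g' × P ≡ P'
  twoBlock-injective v v' e
    with ≤-antisym (≮⇒≥ (twoBlock-≮-position v' v (sym e))) (≮⇒≥ (twoBlock-≮-position v v' e))
  ... | refl with ≤-antisym (≮⇒≥ (twoBlock-≮-left v' v (sym e))) (≮⇒≥ (twoBlock-≮-left v v' e))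
  ... | refl with ≤-antisym (≮⇒≥ (twoBlock-≮-gap v' v (sym e))) (≮⇒≥ (twoBlock-≮-gap v v' e))
  ... | refl = refl , refl , refl

  Layout-position : ∀ {h s g P} → Fits s g P → Layout h (twoBlock s g P) → h s g ≡ P
  Layout-position v (inj₁ (_ , _ , e)) = ⊥-elim (twoBlock≢block v e)
  Layout-position v (inj₂ (_ , _ , _ , v' , e , h≡)) with twoBlock-injective v v' e
  ... | refl , refl , refl = sym h≡

  Moves : (h h' : ℕ → ℕ → ℕ) → ℕ → ℕ → ℕ → Set
  Moves h h' s g P = h s g ≡ P × h' s g ≡ suc P × (∀ s₂ g₂ → ¬ (s₂ ≡ s × g₂ ≡ g) → h' s₂ g₂ ≡ h s₂ g₂)

  Layout-swap : ∀ {h h' s g P} → Fits s g P → Fits s g (suc P) → Moves h h' s g P →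
                SwapAt (twoBlock s g P) (twoBlock s g (suc P)) (Layout h) (Layout h')
  Layout-swap {h} {h'} {s} {g} {P} v v' (h≡ , h'≡ , others) =
    inj₁ (U∈ , V∉) , λ Y → (λ { refl → mk⇔ (λ c → ⊥-elim (U∉′ c)) (λ c → ⊥-elim (V∉ c)) })
                         , (λ { refl → mk⇔ (λ _ → U∈) (λ _ → V∈′) })
                         , (λ Y≢U Y≢V → mk⇔ (to Y≢V) (from Y≢U))
    where
    U∈ : Layout h (twoBlock s g P)
    U∈ = inj₂ (s , g , P , v , refl , sym h≡)
    V∈′ : Layout h' (twoBlock s g (suc P))
    V∈′ = inj₂ (s , g , suc P , v' , refl , sym h'≡)
    V∉ : ¬ Layout h (twoBlock s g (suc P))
    V∉ c = 1+n≢n (sym (trans (sym h≡) (Layout-position v' c)))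
    U∉′ : ¬ Layout h' (twoBlock s g P)
    U∉′ c = 1+n≢n (trans (sym h'≡) (Layout-position v c))
    to : ∀ {Y} → Y ≢ twoBlock s g (suc P) → Layout h' Y → Layout h Y
    to _ (inj₁ x) = inj₁ x
    to Y≢V (inj₂ (s₂ , g₂ , P₂ , v₂ , e , P₂≡)) with (s₂ ≟ s) ×-dec (g₂ ≟ g)
    ... | yes (refl , refl) = ⊥-elim (Y≢V (trans e (cong (twoBlock s g) (trans P₂≡ h'≡))))
    ... | no other = inj₂ (s₂ , g₂ , P₂ , v₂ , e , trans P₂≡ (others s₂ g₂ other))
    from : ∀ {Y} → Y ≢ twoBlock s g P → Layout h Y → Layout h' Y
    from _ (inj₁ x) = inj₁ x
    from Y≢U (inj₂ (s₂ , g₂ , P₂ , v₂ , e , P₂≡)) with (s₂ ≟ s) ×-dec (g₂ ≟ g)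
    ... | yes (refl , refl) = ⊥-elim (Y≢U (trans e (cong (twoBlock s g) (trans P₂≡ h≡))))
    ... | no other = inj₂ (s₂ , g₂ , P₂ , v₂ , e , trans P₂≡ (sym (others s₂ g₂ other)))

  -- A degenerate shape (s = 0, g = 0 or s = m) gives an interval.
  Layout-twoBlock : ∀ {h} s g P → s ≤ m → P + m + g ≤ N → (Fits s g P → h s g ≡ P) → Layout h (twoBlock s g P)
  Layout-twoBlock zero g P _ end≤N _ =
    inj₁ (P + 0 + g , ≤-trans (≤-reflexive (shuffle P m g)) end≤N ,
          trans (cong (_∪ block N (P + 0 + g) m) (block-empty N P)) (∪-identityˡ _))
    where
    shuffle : ∀ P m g → P + 0 + g + m ≡ P + m + g
    shuffle = solve-∀
  Layout-twoBlock s@(suc _) zero P s≤m end≤N _ =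
    inj₁ (P , subst (_≤ N) (+-identityʳ (P + m)) end≤N ,
          block-adjacent (sym (+-identityʳ (P + s))) (m+[n∸m]≡n s≤m))
  Layout-twoBlock s@(suc _) g@(suc _) P s≤m end≤N h≡ with m≤n⇒m<n∨m≡n s≤m
  ... | inj₁ s<m = inj₂ (s , g , P , fits , refl , sym (h≡ fits))
    where
    fits : Fits s g P
    fits = s≤s z≤n , s<m , s≤s z≤n , end≤N
  ... | inj₂ s≡m =
    inj₁ (P , ≤-trans (m≤m+n (P + m) g) end≤N ,
          trans (cong₂ _∪_ (cong (block N P) s≡m) (trans (cong (block N _) (trans (cong (m ∸_) s≡m) (n∸n≡0 m))) (block-empty N _)))
                (∪-identityʳ _))

  -- The points i = P < j = P + s < k = P + s + g < l = P + m + g, and X, the two-block set of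
  -- shape (s, g) at P without i and k.
  module FlipFrame (P s' g' t' : ℕ) (m≡ : m ≡ suc s' + suc t') (l<N : P + m + suc g' < N) where

    open CommutativeMonoidSolver (∪-commutativeMonoid N) using (solve; _⊕_; _⊜_)

    s g t k₀ l₀ : ℕ
    s = suc s'
    g = suc g'
    t = suc t'
    k₀ = P + s + g
    l₀ = P + m + g

    s<m : s < m
    s<m = subst (s <_) (sym m≡) (m<m+n s (s≤s z≤n))

    m∸s≡t : m ∸ s ≡ t
    m∸s≡t = trans (cong (_∸ s) m≡) (m+n∸m≡n s t)

    i<j : P < P + s
    i<j = m<m+n P (s≤s z≤n)
    j<k : P + s < k₀
    j<k = m<m+n (P + s) (s≤s z≤n)
    k<l : k₀ < l₀
    k<l = +-monoˡ-< g (+-monoʳ-< P s<m)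
    k<N : k₀ < N
    k<N = <-trans k<l l<N
    j<N : P + s < N
    j<N = <-trans j<k k<N
    i<N : P < N
    i<N = <-trans i<j j<N

    i j k l : Fin N
    i = F.fromℕ< i<N
    j = F.fromℕ< j<N
    k = F.fromℕ< k<N
    l = F.fromℕ< l<N

    A B X : Subset N
    A = block N (suc P) s'
    B = block N (suc k₀) t'
    X = A ∪ B

    A-end : suc P + s' ≡ P + s
    A-end = sym (+-suc P s')

    B-end : suc k₀ + t' ≡ l₀
    B-end = trans (shuffle P s' g' t') (cong (λ z → P + z + g) (sym m≡))
      where
      shuffle : ∀ P s' g' t' → suc (P + suc s' + suc g' + t') ≡ P + (suc s' + suc t') + suc g'
      shuffle = solve-∀

    bit-A-above : ∀ y → P + s ≤ y → bit A y ≡ false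
    bit-A-above y p = bit-block-above N (suc P) s' y (subst (_≤ y) (sym A-end) p)

    bit-B-below : ∀ y → y < suc k₀ → bit B y ≡ false
    bit-B-below y = bit-block-below N (suc k₀) t' y

    i∉X : i ∉ X
    i∉X = fromℕ<-∉ P i<N (bit-∪-false A B P (bit-block-below N (suc P) s' P (n<1+n P))
                                              (bit-B-below P (<-trans (<-trans i<j j<k) (n<1+n k₀))))
    j∉X : j ∉ X
    j∉X = fromℕ<-∉ (P + s) j<N (bit-∪-false A B _ (bit-A-above _ ≤-refl) (bit-B-below _ (<-trans j<k (n<1+n k₀))))
    k∉X : k ∉ X
    k∉X = fromℕ<-∉ k₀ k<N (bit-∪-false A B _ (bit-A-above _ (<⇒≤ j<k)) (bit-B-below _ (n<1+n k₀)))
    l∉X : l ∉ X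
    l∉X = fromℕ<-∉ l₀ l<N (bit-∪-false A B _ (bit-A-above _ (<⇒≤ (<-trans j<k k<l)))
                                              (bit-block-above N (suc k₀) t' l₀ (≤-reflexive B-end)))

    ∣X∣+2≡m : ∣ X ∣ + 2 ≡ m
    ∣X∣+2≡m = trans (cong (_+ 2) (∣block∪block∣ N (suc P) s' (suc k₀) t' A≤B B≤N)) (trans (shuffle s' t') (sym m≡))
      where
      A≤B : suc P + s' ≤ suc k₀
      A≤B = ≤-trans (≤-reflexive A-end) (≤-trans (<⇒≤ j<k) (n≤1+n k₀))
      B≤N : suc k₀ + t' ≤ N
      B≤N = ≤-trans (≤-reflexive B-end) (<⇒≤ l<N)
      shuffle : ∀ s' t' → s' + t' + 2 ≡ suc s' + suc t'
      shuffle = solve-∀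

    I J K L : Subset N
    I = block N P 1
    J = block N (P + s) 1
    K = block N k₀ 1
    L = block N l₀ 1

    IA : I ∪ A ≡ block N P s
    IA = block-adjacent (+-comm P 1) refl
    AJ : A ∪ J ≡ block N (suc P) s
    AJ = block-adjacent A-end (+-comm s' 1)
    KB : K ∪ B ≡ block N k₀ t
    KB = block-adjacent (+-comm k₀ 1) refl
    BL : B ∪ L ≡ block N (suc k₀) t
    BL = block-adjacent B-end (+-comm t' 1)

    points-cong : ∀ {a b : Fin N} {Ia Ib} → ⁅ a ⁆ ≡ Ia → ⁅ b ⁆ ≡ Ib → X ∪ ⁅ a ⁆ ∪ ⁅ b ⁆ ≡ X ∪ Ia ∪ Ib
    points-cong = cong₂ (λ a b → X ∪ a ∪ b)

    ⁅i⁆ : ⁅ i ⁆ ≡ I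
    ⁅i⁆ = ⁅fromℕ<⁆≡block P i<N
    ⁅j⁆ : ⁅ j ⁆ ≡ J
    ⁅j⁆ = ⁅fromℕ<⁆≡block _ j<N
    ⁅k⁆ : ⁅ k ⁆ ≡ K
    ⁅k⁆ = ⁅fromℕ<⁆≡block _ k<N
    ⁅l⁆ : ⁅ l ⁆ ≡ L
    ⁅l⁆ = ⁅fromℕ<⁆≡block _ l<N

    X-ik : X ∪ ⁅ i ⁆ ∪ ⁅ k ⁆ ≡ twoBlock s g P
    X-ik = trans (points-cong ⁅i⁆ ⁅k⁆)
      (trans (solve 4 (λ a b c d → (a ⊕ b) ⊕ (c ⊕ d) ⊜ (c ⊕ a) ⊕ (d ⊕ b)) refl A B I K)
        (cong₂ _∪_ IA (trans KB (cong (block N k₀) (sym m∸s≡t)))))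

    X-jl : X ∪ ⁅ j ⁆ ∪ ⁅ l ⁆ ≡ twoBlock s g (suc P)
    X-jl = trans (points-cong ⁅j⁆ ⁅l⁆)
      (trans (solve 4 (λ a b c d → (a ⊕ b) ⊕ (c ⊕ d) ⊜ (a ⊕ c) ⊕ (b ⊕ d)) refl A B J L)
        (cong₂ _∪_ AJ (trans BL (cong (block N (suc k₀)) (sym m∸s≡t)))))

    X-ij : X ∪ ⁅ i ⁆ ∪ ⁅ j ⁆ ≡ twoBlock (suc s) g P
    X-ij = trans (points-cong ⁅i⁆ ⁅j⁆)
      (trans (solve 4 (λ a b c d → (a ⊕ b) ⊕ (c ⊕ d) ⊜ (c ⊕ (a ⊕ d)) ⊕ b) refl A B I J)
        (cong₂ _∪_ (trans (cong (I ∪_) AJ) (block-adjacent (+-comm P 1) refl))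
                   (cong₂ (block N) (shuffle P s g) (sym m∸1+s≡t'))))
      where
      shuffle : ∀ P s g → suc (P + s + g) ≡ P + suc s + g
      shuffle = solve-∀
      m∸1+s≡t' : m ∸ suc s ≡ t'
      m∸1+s≡t' = trans (cong (_∸ suc s) (trans m≡ (+-suc s t'))) (m+n∸m≡n (suc s) t')

    X-kl : X ∪ ⁅ k ⁆ ∪ ⁅ l ⁆ ≡ twoBlock s' g (suc P)
    X-kl = trans (points-cong ⁅k⁆ ⁅l⁆)
      (trans (solve 4 (λ a b c d → (a ⊕ b) ⊕ (c ⊕ d) ⊜ a ⊕ ((c ⊕ b) ⊕ d)) refl A B K L)
        (cong (A ∪_) (trans (trans (cong (_∪ L) KB) (block-adjacent k₀+t≡l₀ (+-comm t 1)))
                            (cong₂ (block N) (shuffle P s' g) (sym m∸s'≡1+t)))))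
      where
      k₀+t≡l₀ : k₀ + t ≡ l₀
      k₀+t≡l₀ = trans (cong (k₀ +_) (sym m∸s≡t)) (twoBlock-end s g P (<⇒≤ s<m))
      shuffle : ∀ P s' g → P + suc s' + g ≡ suc P + s' + g
      shuffle = solve-∀
      m∸s'≡1+t : m ∸ s' ≡ suc t
      m∸s'≡1+t = trans (cong (_∸ s') (trans m≡ (sym (+-suc s' t)))) (m+n∸m≡n s' (suc t))

    X-il : X ∪ ⁅ i ⁆ ∪ ⁅ l ⁆ ≡ twoBlock s (suc g) P
    X-il = trans (points-cong ⁅i⁆ ⁅l⁆)
      (trans (solve 4 (λ a b c d → (a ⊕ b) ⊕ (c ⊕ d) ⊜ (c ⊕ a) ⊕ (b ⊕ d)) refl A B I L)
        (cong₂ _∪_ IA (trans BL (cong₂ (block N) (sym (+-suc (P + s) g)) (sym m∸s≡t)))))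

    X-jk : X ∪ ⁅ j ⁆ ∪ ⁅ k ⁆ ≡ twoBlock s g' (suc P)
    X-jk = trans (points-cong ⁅j⁆ ⁅k⁆)
      (trans (solve 4 (λ a b c d → (a ⊕ b) ⊕ (c ⊕ d) ⊜ (a ⊕ c) ⊕ (d ⊕ b)) refl A B J K)
        (cong₂ _∪_ AJ (trans KB (cong₂ (block N) (shuffle P s g') (sym m∸s≡t)))))
      where
      shuffle : ∀ P s g' → P + s + suc g' ≡ suc P + s + g'
      shuffle = solve-∀

  -- Shape (s, g) can move from P to P + 1 once its lexicographic predecessors (s, g − 1) and
  -- (s − 1, g) have moved and its successors (s, g + 1) and (s + 1, g) have not.
  Layout-flip : ∀ {h h' s' g' P} → Fits (suc s') (suc g') (suc P) → Moves h h' (suc s') (suc g') P →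
    (Fits (suc (suc s')) (suc g') P → h (suc (suc s')) (suc g') ≡ P) →
    (Fits s' (suc g') (suc P) → h s' (suc g') ≡ suc P) →
    (Fits (suc s') (suc (suc g')) P → h (suc s') (suc (suc g')) ≡ P) →
    (Fits (suc s') g' (suc P) → h (suc s') g' ≡ suc P) →
    Flip4 m (Layout h) (Layout h')
  Layout-flip {h} {h'} {s'} {g'} {P} v'@(_ , 1+s'<m , _ , l<N) moves h-ij h-kl h-il h-jk with m ∸ suc s' in m∸s≡
  ... | zero = ⊥-elim (m>n⇒m∸n≢0 1+s'<m m∸s≡)
  ... | suc t' =
    i , j , k , l , X , fromℕ<-mono i<N j<N i<j , fromℕ<-mono j<N k<N j<k , fromℕ<-mono k<N l<N k<l ,
    i∉X , j∉X , k∉X , l∉X , ∣X∣+2≡m ,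
    subst (Layout h) (sym X-ij) (Layout-twoBlock _ _ P s<m end≤N h-ij) ,
    subst (Layout h) (sym X-kl) (Layout-twoBlock _ _ (suc P) (≤-trans (n≤1+n s') (<⇒≤ s<m)) l<N h-kl) ,
    subst (Layout h) (sym X-il) (Layout-twoBlock _ _ P (<⇒≤ s<m) (≤-trans (≤-reflexive (+-suc (P + m) _)) l<N) h-il) ,
    subst (Layout h) (sym X-jk) (Layout-twoBlock _ _ (suc P) (<⇒≤ s<m) (≤-trans (+-monoʳ-≤ (suc P + m) (n≤1+n g')) l<N) h-jk) ,
    subst₂ (λ U V → SwapAt U V (Layout h) (Layout h')) (sym X-ik) (sym X-jl) (Layout-swap v v' moves)
    where
    open FlipFrame P s' g' t' (trans (sym (m+[n∸m]≡n (<⇒≤ 1+s'<m))) (cong (suc s' +_) m∸s≡)) l<N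
    end≤N : P + m + suc g' ≤ N
    end≤N = ≤-trans (n≤1+n _) l<N
    v : Fits (suc s') (suc g') P
    v = s≤s z≤n , 1+s'<m , s≤s z≤n , end≤N

  Layout-cong : ∀ {h h'} → (∀ s g → 1 ≤ s → s < m → 1 ≤ g → m + g ≤ N → h s g ≡ h' s g) → Layout h ≐ Layout h'
  Layout-cong {h} {h'} h≗h' Y = mk⇔ to from
    where
    m+g≤N : ∀ {s g P} → Fits s g P → m + g ≤ N
    m+g≤N {g = g} {P} (_ , _ , _ , fits) = ≤-trans (m≤n+m (m + g) P) (≤-trans (≤-reflexive (sym (+-assoc P m g))) fits)
    to : Layout h Y → Layout h' Y
    to (inj₁ x) = inj₁ x
    to (inj₂ (s , g , P , v@(1≤s , s<m , 1≤g , _) , e , P≡)) = inj₂ (s , g , P , v , e , trans P≡ (h≗h' s g 1≤s s<m 1≤g (m+g≤N v)))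
    from : Layout h' Y → Layout h Y
    from (inj₁ x) = inj₁ x
    from (inj₂ (s , g , P , v@(1≤s , s<m , 1≤g , _) , e , P≡)) = inj₂ (s , g , P , v , e , trans P≡ (sym (h≗h' s g 1≤s s<m 1≤g (m+g≤N v))))

  -- After R rounds every shape has moved R steps right, or as far as it fits.
  capped : ℕ → ℕ → ℕ → ℕ
  capped R s g = R ⊓ (N ∸ (m + g))

  capped-fits : ∀ R s g → R + (m + g) ≤ N → capped R s g ≡ R
  capped-fits R s g p = m≤n⇒m⊓n≡m (m+n≤o⇒m≤o∸n R p)

  ¬fits⇒cap≤ : ∀ R g → ¬ (suc R + m + g ≤ N) → N ∸ (m + g) ≤ R
  ¬fits⇒cap≤ R g ¬fits = ≤-pred (m<n+o⇒m∸n<o N (m + g) {suc R} (subst (N <_) (shuffle R m g) (≰⇒> ¬fits)))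
    where
    shuffle : ∀ R m g → suc R + m + g ≡ m + g + suc R
    shuffle = solve-∀

  Before : ℕ → ℕ → ℕ → ℕ → Bool
  Before s₀ g₀ s g = does (s <? s₀) ∨ (does (s ≟ s₀) ∧ does (g <? g₀))

  -- Round R + 1 in progress: the shapes before (s₀, g₀) have been moved to R + 1 where they fit.
  sweeping : ℕ → ℕ → ℕ → ℕ → ℕ → ℕ
  sweeping R s₀ g₀ s g = if Before s₀ g₀ s g ∧ does (suc R + m + g ≤? N) then suc R else capped R s g

  sweeping-moved : ∀ R s₀ g₀ s g → Before s₀ g₀ s g ≡ true → suc R + m + g ≤ N → sweeping R s₀ g₀ s g ≡ suc R
  sweeping-moved R s₀ g₀ s g before fits =
    cong (λ b → if b then suc R else capped R s g) (cong₂ _∧_ before (dec-true (suc R + m + g ≤? N) fits))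

  sweeping-pending : ∀ R s₀ g₀ s g → Before s₀ g₀ s g ≡ false → sweeping R s₀ g₀ s g ≡ capped R s g
  sweeping-pending R s₀ g₀ s g ¬before = cong (λ b → if b ∧ does (suc R + m + g ≤? N) then suc R else capped R s g) ¬before

  sweeping-stuck : ∀ R s₀ g₀ s g → ¬ (suc R + m + g ≤ N) → sweeping R s₀ g₀ s g ≡ capped R s g
  sweeping-stuck R s₀ g₀ s g ¬fits = cong (λ b → if b then suc R else capped R s g)
    (trans (cong (Before s₀ g₀ s g ∧_) (dec-false (suc R + m + g ≤? N) ¬fits)) (∧-zeroʳ _))

  sweeping-cong : ∀ R s₀ g₀ s₁ g₁ s g → Before s₀ g₀ s g ≡ Before s₁ g₁ s g → sweeping R s₀ g₀ s g ≡ sweeping R s₁ g₁ s g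
  sweeping-cong R s₀ g₀ s₁ g₁ s g e = cong (λ b → if b ∧ does (suc R + m + g ≤? N) then suc R else capped R s g) e

  Before-< : ∀ s₀ g₀ s g → s < s₀ → Before s₀ g₀ s g ≡ true
  Before-< s₀ g₀ s g s<s₀ = cong (_∨ (does (s ≟ s₀) ∧ does (g <? g₀))) (dec-true (s <? s₀) s<s₀)

  Before-≡< : ∀ s₀ g₀ s g → s ≡ s₀ → g < g₀ → Before s₀ g₀ s g ≡ true
  Before-≡< s₀ g₀ s g s≡s₀ g<g₀ = cong₂ _∨_ (dec-false (s <? s₀) (λ s<s₀ → <⇒≢ s<s₀ s≡s₀))
                                             (cong₂ _∧_ (dec-true (s ≟ s₀) s≡s₀) (dec-true (g <? g₀) g<g₀))

  Before-> : ∀ s₀ g₀ s g → s₀ < s → Before s₀ g₀ s g ≡ false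
  Before-> s₀ g₀ s g s₀<s = cong₂ _∨_ (dec-false (s <? s₀) (λ s<s₀ → <-asym s<s₀ s₀<s))
                                      (cong (_∧ does (g <? g₀)) (dec-false (s ≟ s₀) (λ s≡s₀ → <⇒≢ s₀<s (sym s≡s₀))))

  Before-≡≥ : ∀ s₀ g₀ s g → s ≡ s₀ → g₀ ≤ g → Before s₀ g₀ s g ≡ false
  Before-≡≥ s₀ g₀ s g s≡s₀ g₀≤g = cong₂ _∨_ (dec-false (s <? s₀) (λ s<s₀ → <⇒≢ s<s₀ s≡s₀))
    (trans (cong (does (s ≟ s₀) ∧_) (dec-false (g <? g₀) (λ g<g₀ → <⇒≱ g<g₀ g₀≤g))) (∧-zeroʳ (does (s ≟ s₀))))

  Before-next : ∀ s₀ g₀ s g → ¬ (s ≡ s₀ × g ≡ g₀) → Before s₀ (suc g₀) s g ≡ Before s₀ g₀ s g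
  Before-next s₀ g₀ s g ≢ with <-cmp s s₀
  ... | tri< p _ _ = trans (Before-< s₀ (suc g₀) s g p) (sym (Before-< s₀ g₀ s g p))
  ... | tri> _ _ p = trans (Before-> s₀ (suc g₀) s g p) (sym (Before-> s₀ g₀ s g p))
  ... | tri≈ _ p _ with <-cmp g g₀
  ... | tri< q _ _ = trans (Before-≡< s₀ (suc g₀) s g p (≤-trans q (n≤1+n g₀))) (sym (Before-≡< s₀ g₀ s g p q))
  ... | tri≈ _ q _ = ⊥-elim (≢ (p , q))
  ... | tri> _ _ q = trans (Before-≡≥ s₀ (suc g₀) s g p q) (sym (Before-≡≥ s₀ g₀ s g p (<⇒≤ q)))

  Before-next-row : ∀ s₀ s g → 1 ≤ g → g ≤ N → Before s₀ (suc N) s g ≡ Before (suc s₀) 1 s g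
  Before-next-row s₀ s g 1≤g g≤N with <-cmp s s₀
  ... | tri< p _ _ = trans (Before-< s₀ (suc N) s g p) (sym (Before-< (suc s₀) 1 s g (≤-trans p (n≤1+n s₀))))
  ... | tri≈ _ p _ = trans (Before-≡< s₀ (suc N) s g p (s≤s g≤N)) (sym (Before-< (suc s₀) 1 s g (s≤s (≤-reflexive p))))
  ... | tri> _ _ p with <-cmp s (suc s₀)
  ... | tri< q _ _ = ⊥-elim (<⇒≱ p (≤-pred q))
  ... | tri≈ _ q _ = trans (Before-> s₀ (suc N) s g p) (sym (Before-≡≥ (suc s₀) 1 s g q 1≤g))
  ... | tri> _ _ q = trans (Before-> s₀ (suc N) s g p) (sym (Before-> (suc s₀) 1 s g q))

  Layout-capped-0⊆𝓘𝓢 : 1 ≤ m → ∀ Y → Layout (capped 0) Y → 𝓘𝓢 N m Y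
  Layout-capped-0⊆𝓘𝓢 1≤m Y (inj₁ (a , a+m≤N , e)) =
    inj₁ (suc a , a + m , s≤s z≤n , ≤-trans (≤-reflexive (+-comm 1 a)) (+-monoʳ-≤ a 1≤m) , a+m≤N ,
          trans e (sym (⟦⟧≡block N a m)) , trans (cong ∣_∣ e) (∣block∣ N a m a+m≤N))
  Layout-capped-0⊆𝓘𝓢 1≤m Y (inj₂ (s , g , .0 , (1≤s , s<m , 1≤g , fits) , e , refl)) =
    inj₂ (s , suc (s + g) , s + g + t , 1≤s , gap<last , s≤s (+-monoʳ-≤ s 1≤g) , end≤N ,
          trans e (sym (cong₂ _∪_ (⟦⟧≡block N 0 s) (⟦⟧≡block N (s + g) t))) ,
          trans (cong ∣_∣ e) (trans (∣block∪block∣ N 0 s (s + g) t (m≤m+n s g) end≤N) (m+[n∸m]≡n (<⇒≤ s<m))))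
    where
    t : ℕ
    t = m ∸ s
    gap<last : suc (s + g) ≤ s + g + t
    gap<last = ≤-trans (≤-reflexive (+-comm 1 (s + g))) (+-monoʳ-≤ (s + g) (m<n⇒0<n∸m s<m))
    end≤N : s + g + t ≤ N
    end≤N = ≤-trans (≤-reflexive (twoBlock-end s g 0 (<⇒≤ s<m))) fits

  𝓘𝓢⊆Layout-capped-0 : ∀ Y → 𝓘𝓢 N m Y → Layout (capped 0) Y
  𝓘𝓢⊆Layout-capped-0 Y (inj₁ (suc a , q , _ , a<q , q≤N , e , ∣Y∣≡m)) with m≤n⇒∃[o]m+o≡n (≤-trans (n≤1+n a) a<q)
  ... | l , refl = inj₁ (a , subst (λ z → a + z ≤ N) l≡m q≤N , subst (λ z → Y ≡ block N a z) l≡m Y≡)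
    where
    Y≡ : Y ≡ block N a l
    Y≡ = trans e (⟦⟧≡block N a l)
    l≡m : l ≡ m
    l≡m = trans (sym (∣block∣ N a l q≤N)) (trans (cong ∣_∣ (sym Y≡)) ∣Y∣≡m)
  𝓘𝓢⊆Layout-capped-0 Y (inj₂ (p , suc q′ , r , 1≤p , q≤r , p+1<q , r≤N , e , ∣Y∣≡m))
    with m≤n⇒∃[o]m+o≡n (<⇒≤ (≤-pred (subst (_< suc q′) (+-comm p 1) p+1<q)))
  ... | g , refl with m≤n⇒∃[o]m+o≡n (≤-trans (n≤1+n (p + g)) q≤r)
  ... | l , refl = inj₂ (p , g , 0 , (1≤p , p<m , 1≤g , end≤N) , Y≡twoBlock , refl)
    where
    1≤g : 1 ≤ g
    1≤g = +-cancelˡ-≤ p 1 g (subst (_≤ p + g) (+-comm 1 p) (≤-pred (subst (_< suc (p + g)) (+-comm p 1) p+1<q)))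
    1≤l : 1 ≤ l
    1≤l = +-cancelˡ-≤ (p + g) 1 l (subst (_≤ p + g + l) (+-comm 1 (p + g)) q≤r)
    Y≡ : Y ≡ block N 0 p ∪ block N (p + g) l
    Y≡ = trans e (cong₂ _∪_ (⟦⟧≡block N 0 p) (⟦⟧≡block N (p + g) l))
    p+l≡m : p + l ≡ m
    p+l≡m = trans (sym (∣block∪block∣ N 0 p (p + g) l (m≤m+n p g) r≤N)) (trans (cong ∣_∣ (sym Y≡)) ∣Y∣≡m)
    p<m : p < m
    p<m = subst (p <_) p+l≡m (m<m+n p 1≤l)
    end≤N : 0 + m + g ≤ N
    end≤N = ≤-trans (≤-reflexive (trans (cong (_+ g) (sym p+l≡m)) (shuffle p l g))) r≤N
      where
      shuffle : ∀ p l g → p + l + g ≡ p + g + l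
      shuffle = solve-∀
    Y≡twoBlock : Y ≡ twoBlock p g 0
    Y≡twoBlock = trans Y≡ (cong (λ z → block N 0 p ∪ block N (p + g) z) (trans (sym (m+n∸m≡n p l)) (cong (_∸ p) p+l≡m)))

  Layout-capped-0≐𝓘𝓢 : 1 ≤ m → Layout (capped 0) ≐ 𝓘𝓢 N m
  Layout-capped-0≐𝓘𝓢 1≤m Y = mk⇔ (Layout-capped-0⊆𝓘𝓢 1≤m Y) (𝓘𝓢⊆Layout-capped-0 Y)

  sweep-step : ∀ {S} R s₀ g₀ → 1 ≤ s₀ → s₀ < m → 1 ≤ g₀ →
               Reach (Flip4 m) S (Layout (sweeping R s₀ g₀)) → Reach (Flip4 m) S (Layout (sweeping R s₀ (suc g₀)))
  sweep-step R s₀ g₀ _ _ _ r with suc R + m + g₀ ≤? N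
  sweep-step R (suc s') (suc g') _ s₀<m _ r | yes fits =
    step r (Layout-flip (s≤s z≤n , s₀<m , s≤s z≤n , fits) (h≡ , h'≡ , others) (λ _ → h-ij) (λ _ → h-kl) (λ _ → h-il) (λ _ → h-jk))
    where
    s₀ g₀ : ℕ
    s₀ = suc s'
    g₀ = suc g'
    h h' : ℕ → ℕ → ℕ
    h = sweeping R s₀ g₀
    h' = sweeping R s₀ (suc g₀)
    R-fits-right : R + (m + suc g₀) ≤ N
    R-fits-right = ≤-trans (≤-reflexive (shuffle R m g₀)) fits
      where
      shuffle : ∀ R m g → R + (m + suc g) ≡ suc R + m + g
      shuffle = solve-∀
    R-fits : R + (m + g₀) ≤ N
    R-fits = ≤-trans (+-monoʳ-≤ R (+-monoʳ-≤ m (n≤1+n g₀))) R-fits-right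
    h≡ : h s₀ g₀ ≡ R
    h≡ = trans (sweeping-pending R s₀ g₀ s₀ g₀ (Before-≡≥ s₀ g₀ s₀ g₀ refl ≤-refl)) (capped-fits R s₀ g₀ R-fits)
    h'≡ : h' s₀ g₀ ≡ suc R
    h'≡ = sweeping-moved R s₀ (suc g₀) s₀ g₀ (Before-≡< s₀ (suc g₀) s₀ g₀ refl (n<1+n g₀)) fits
    others : ∀ s₂ g₂ → ¬ (s₂ ≡ s₀ × g₂ ≡ g₀) → h' s₂ g₂ ≡ h s₂ g₂
    others s₂ g₂ other = sweeping-cong R s₀ (suc g₀) s₀ g₀ s₂ g₂ (Before-next s₀ g₀ s₂ g₂ other)
    h-ij : h (suc s₀) g₀ ≡ R
    h-ij = trans (sweeping-pending R s₀ g₀ (suc s₀) g₀ (Before-> s₀ g₀ (suc s₀) g₀ (n<1+n s₀))) (capped-fits R (suc s₀) g₀ R-fits)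
    h-kl : h s' g₀ ≡ suc R
    h-kl = sweeping-moved R s₀ g₀ s' g₀ (Before-< s₀ g₀ s' g₀ (n<1+n s')) fits
    h-il : h s₀ (suc g₀) ≡ R
    h-il = trans (sweeping-pending R s₀ g₀ s₀ (suc g₀) (Before-≡≥ s₀ g₀ s₀ (suc g₀) refl (n≤1+n g₀)))
                 (capped-fits R s₀ (suc g₀) R-fits-right)
    h-jk : h s₀ g' ≡ suc R
    h-jk = sweeping-moved R s₀ g₀ s₀ g' (Before-≡< s₀ g₀ s₀ g' refl (n<1+n g')) (≤-trans (+-monoʳ-≤ (suc R + m) (n≤1+n g')) fits)
  sweep-step R s₀ g₀ _ _ _ r | no ¬fits = Reach-≐ r (Layout-cong unchanged)
    where
    unchanged : ∀ s g → 1 ≤ s → s < m → 1 ≤ g → m + g ≤ N → sweeping R s₀ g₀ s g ≡ sweeping R s₀ (suc g₀) s g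
    unchanged s g _ _ _ _ with (s ≟ s₀) ×-dec (g ≟ g₀)
    ... | yes (refl , refl) = trans (sweeping-stuck R s₀ g₀ s g ¬fits) (sym (sweeping-stuck R s₀ (suc g₀) s g ¬fits))
    ... | no other = sweeping-cong R s₀ g₀ s₀ (suc g₀) s g (sym (Before-next s₀ g₀ s g other))

  sweep-row : ∀ {S} R s₀ → 1 ≤ s₀ → s₀ < m → ∀ g →
              Reach (Flip4 m) S (Layout (sweeping R s₀ 1)) → Reach (Flip4 m) S (Layout (sweeping R s₀ (suc g)))
  sweep-row R s₀ 1≤s₀ s₀<m zero r = r
  sweep-row R s₀ 1≤s₀ s₀<m (suc g) r = sweep-step R s₀ (suc g) 1≤s₀ s₀<m (s≤s z≤n) (sweep-row R s₀ 1≤s₀ s₀<m g r)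

  sweep-rows : ∀ {S} R s → suc s ≤ m →
               Reach (Flip4 m) S (Layout (sweeping R 1 1)) → Reach (Flip4 m) S (Layout (sweeping R (suc s) 1))
  sweep-rows R zero _ r = r
  sweep-rows R (suc s) s+2≤m r =
    Reach-≐ (sweep-row R (suc s) (s≤s z≤n) s+2≤m N (sweep-rows R s (<⇒≤ s+2≤m) r)) (Layout-cong next-row)
    where
    next-row : ∀ s₂ g → 1 ≤ s₂ → s₂ < m → 1 ≤ g → m + g ≤ N → sweeping R (suc s) (suc N) s₂ g ≡ sweeping R (suc (suc s)) 1 s₂ g
    next-row s₂ g _ _ 1≤g m+g≤N = sweeping-cong R (suc s) (suc N) (suc (suc s)) 1 s₂ g (Before-next-row (suc s) s₂ g 1≤g (≤-trans (m≤n+m g m) m+g≤N))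

  round : ∀ {S} R → 1 ≤ m → Reach (Flip4 m) S (Layout (capped R)) → Reach (Flip4 m) S (Layout (capped (suc R)))
  round R 1≤m r =
    Reach-≐ (sweep-rows R (m ∸ 1) (≤-reflexive (m+[n∸m]≡n 1≤m)) (Reach-≐ r (Layout-cong start))) (Layout-cong finish)
    where
    start : ∀ s g → 1 ≤ s → s < m → 1 ≤ g → m + g ≤ N → capped R s g ≡ sweeping R 1 1 s g
    start s g 1≤s _ 1≤g _ with m≤n⇒m<n∨m≡n 1≤s
    ... | inj₁ 1<s = sym (sweeping-pending R 1 1 s g (Before-> 1 1 s g 1<s))
    ... | inj₂ 1≡s = sym (sweeping-pending R 1 1 s g (Before-≡≥ 1 1 s g (sym 1≡s) 1≤g))
    finish : ∀ s g → 1 ≤ s → s < m → 1 ≤ g → m + g ≤ N → sweeping R (suc (m ∸ 1)) 1 s g ≡ capped (suc R) s g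
    finish s g _ s<m _ _ with suc R + m + g ≤? N
    ... | yes fits = trans (sweeping-moved R _ 1 s g (Before-< _ 1 s g (≤-trans s<m (≤-reflexive (sym (m+[n∸m]≡n 1≤m))))) fits)
                           (sym (capped-fits (suc R) s g (≤-trans (≤-reflexive (sym (+-assoc (suc R) m g))) fits)))
    ... | no ¬fits = trans (sweeping-stuck R _ 1 s g ¬fits)
                       (trans (m≥n⇒m⊓n≡n cap≤R) (sym (m≥n⇒m⊓n≡n (≤-trans cap≤R (n≤1+n R)))))
      where
      cap≤R : N ∸ (m + g) ≤ R
      cap≤R = ¬fits⇒cap≤ R g ¬fits

  rightmost : ℕ → ℕ → ℕ
  rightmost s g = N ∸ (m + g)

  𝓘𝓢-reaches-rightmost : 1 ≤ m → Reach (Flip4 m) (𝓘𝓢 N m) (Layout rightmost)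
  𝓘𝓢-reaches-rightmost 1≤m = Reach-≐ (rounds N) (Layout-cong (λ s g _ _ _ _ → m≥n⇒m⊓n≡n (m∸n≤m N (m + g))))
    where
    rounds : ∀ R → Reach (Flip4 m) (𝓘𝓢 N m) (Layout (capped R))
    rounds zero = base (Layout-capped-0≐𝓘𝓢 1≤m)
    rounds (suc R) = round R 1≤m (rounds R)

block-pad : ∀ n n' a l → a + l ≤ n → block n a l ++ replicate n' false ≡ block (n + n') a l
block-pad zero n' zero zero p = sym (block-empty n' 0)
block-pad (suc n) n' (suc a) l (s≤s p) = cong (false ∷_) (block-pad n n' a l p)
block-pad (suc n) n' zero (suc l) (s≤s p) = cong (true ∷_) (block-pad n n' zero l p)
block-pad (suc n) n' zero zero p = cong (false ∷_) (block-pad n n' zero zero z≤n)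

⊥-pad : ∀ n n' → S.⊥ {n} ++ replicate n' false ≡ S.⊥ {n + n'}
⊥-pad zero n' = refl
⊥-pad (suc n) n' = cong (false ∷_) (⊥-pad n n')

∪-pad : ∀ {n} n' (A B : Subset n) → (A ∪ B) ++ replicate n' false ≡ (A ++ replicate n' false) ∪ (B ++ replicate n' false)
∪-pad n' [] [] = sym (∪-identityˡ (replicate n' false))
∪-pad n' (a ∷ A) (b ∷ B) = cong ((a ∨ b) ∷_) (∪-pad n' A B)

⁅⁆-pad : ∀ {n} n' (i : Fin n) → ⁅ i ⁆ ++ replicate n' false ≡ ⁅ i ↑ˡ n' ⁆
⁅⁆-pad {suc n} n' F.zero = cong (true ∷_) (⊥-pad n n')
⁅⁆-pad {suc n} n' (F.suc i) = cong (false ∷_) (⁅⁆-pad n' i)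

bit-pad : ∀ {n} n' (X : Subset n) y → bit (X ++ replicate n' false) y ≡ bit X y
bit-pad n' [] y = bit-⊥ {n'} y
bit-pad n' (b ∷ X) zero = refl
bit-pad n' (b ∷ X) (suc y) = bit-pad n' X y

∣pad∣ : ∀ {n} n' (X : Subset n) → ∣ X ++ replicate n' false ∣ ≡ ∣ X ∣
∣pad∣ n' [] = ∣⊥∣≡0 n'
∣pad∣ n' (false ∷ X) = ∣pad∣ n' X
∣pad∣ n' (true ∷ X) = cong suc (∣pad∣ n' X)

module Embedding (n n' : ℕ) (n≤n' : n ≤ n') where

  N : ℕ
  N = n + n'

  lift : Subset n → Subset N
  lift X = _^Δ {n} {n'} X

  pad : Subset n → Subset N
  pad X = X ++ replicate n' false

  tail : Subset n → Subset N
  tail X = block N (n' + ∣ X ∣) (n ∸ ∣ X ∣)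

  lift-split : ∀ X → lift X ≡ pad X ∪ tail X
  lift-split X = cong (pad X ∪_) (trans (cong₂ ⟦_‥_⟧ (trans (cong (_+ 1) start) (+-comm (n' + x) 1)) end)
                                        (⟦⟧≡block N (n' + x) (n ∸ x)))
    where
    x : ℕ
    x = ∣ X ∣
    n∸x+x : (n ∸ x) + x ≡ n
    n∸x+x = m∸n+n≡m (∣p∣≤n X)
    start : N ∸ (n ∸ x) ≡ n' + x
    start = trans (cong (λ z → z + n' ∸ (n ∸ x)) (sym n∸x+x))
              (trans (cong (_∸ (n ∸ x)) (+-assoc (n ∸ x) x n')) (trans (m+n∸m≡n (n ∸ x) (x + n')) (+-comm x n')))
    end : N ≡ n' + x + (n ∸ x)
    end = trans (+-comm n n') (trans (cong (n' +_) (sym (trans (+-comm x (n ∸ x)) n∸x+x))) (sym (+-assoc n' x (n ∸ x))))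

  bit-lift : ∀ X y → bit (lift X) y ≡ (bit X y ∨ bit (tail X) y)
  bit-lift X y = trans (cong-bit y (lift-split X))
                   (trans (bit-∪ (pad X) (tail X) y) (cong (_∨ bit (tail X) y) (bit-pad n' X y)))

  bit-lift-low : ∀ X y → y < n → bit (lift X) y ≡ bit X y
  bit-lift-low X y y<n =
    trans (bit-lift X y) (trans (cong (bit X y ∨_) (bit-block-below N _ _ y (≤-trans y<n (≤-trans n≤n' (m≤m+n n' _)))))
                                (∨-identityʳ _))

  bit-lift-tail : ∀ X y → n' + ∣ X ∣ ≤ y → y < N → bit (lift X) y ≡ true
  bit-lift-tail X y start≤y y<N =
    trans (bit-lift X y) (trans (cong (bit X y ∨_) (bit-block-inside N _ _ y start≤y (≤-trans y<N (≤-reflexive N≡)) y<N)) (∨-zeroʳ _))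
    where
    N≡ : N ≡ n' + ∣ X ∣ + (n ∸ ∣ X ∣)
    N≡ = trans (+-comm n n') (trans (cong (n' +_) (sym (m+[n∸m]≡n (∣p∣≤n X)))) (sym (+-assoc n' _ _)))

  bit-lift-gap : ∀ X y → n ≤ y → y < n' + ∣ X ∣ → bit (lift X) y ≡ false
  bit-lift-gap X y n≤y y<start = trans (bit-lift X y) (cong₂ _∨_ (bit-beyond X y n≤y) (bit-block-below N _ _ y y<start))

  lift-injective : ∀ {X Z} → lift X ≡ lift Z → X ≡ Z
  lift-injective {X} {Z} e = bit-ext X Z (λ y y<n → trans (sym (bit-lift-low X y y<n)) (trans (cong-bit y e) (bit-lift-low Z y y<n)))

  -- Above n, X^Δ is an empty gap followed by a final block, so unlike every member of 𝓐 it has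
  -- no point y ≥ n followed by a point it misses.
  bit-lift-step : ∀ X y → n ≤ y → suc y < N → bit (lift X) y ≡ true → bit (lift X) (suc y) ≡ true
  bit-lift-step X y n≤y 1+y<N y∈ with n' + ∣ X ∣ ≤? y
  ... | yes start≤y = bit-lift-tail X (suc y) (≤-trans start≤y (n≤1+n y)) 1+y<N
  ... | no y<start = ⊥-elim (true≢false (trans (sym y∈) (bit-lift-gap X y n≤y (≰⇒> y<start))))

  𝓐-edge : ∀ {Y} → 𝓐 n n' Y → ∃[ y ] (n ≤ y × suc y < N × bit Y y ≡ true × bit Y (suc y) ≡ false)
  𝓐-edge (inj₁ (suc a , suc q , _ , s≤s a≤q , s≤s n≤q , q<N , refl , _)) =
    q , n≤q , q<N , bit-⟦⟧-last N a q a≤q (<-trans (n<1+n q) q<N) , bit-⟦⟧-after N a q a≤q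
  𝓐-edge (inj₂ (suc a , suc q , suc r , _ , s≤s a≤q , s≤s n≤q , q+1<r , r≤N , refl , _)) =
    q , n≤q , 1+q<N , trans (bit-∪ L R q) (cong (_∨ bit R q) (bit-⟦⟧-last N a q a≤q (<-trans (n<1+n q) 1+q<N))) ,
    bit-∪-false L R (suc q) (bit-⟦⟧-after N a q a≤q)
      (trans (cong-bit (suc q) (⟦⟧≡block′ N (suc r) N (s≤s z≤n) (≤-trans r≤N (n≤1+n N)))) (bit-block-below N r _ (suc q) 1+q<r))
    where
    L R : Subset N
    L = ⟦ suc a ‥ suc q ⟧
    R = ⟦ suc r ‥ N ⟧
    1+q<r : suc q < r
    1+q<r = ≤-pred (subst (_< suc r) (+-comm (suc q) 1) q+1<r)
    1+q<N : suc q < N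
    1+q<N = <-trans 1+q<r r≤N

  lift∉𝓐 : ∀ X → ¬ 𝓐 n n' (lift X)
  lift∉𝓐 X Y∈𝓐 with 𝓐-edge Y∈𝓐
  ... | y , n≤y , 1+y<N , y∈ , 1+y∉ = true≢false (trans (sym (bit-lift-step X y n≤y 1+y<N y∈)) 1+y∉)

  Δ-lift : ∀ (B : Coll n) X → (B Δ) n' (lift X) ⇔ B X
  Δ-lift B X = mk⇔ to (λ X∈B → inj₂ (X , X∈B , refl))
    where
    to : (B Δ) n' (lift X) → B X
    to (inj₁ a) = ⊥-elim (lift∉𝓐 X a)
    to (inj₂ (Z , Z∈B , e)) = subst B (sym (lift-injective e)) Z∈B

  Δ-cong : ∀ {B C : Coll n} → B ≐ C → (B Δ) n' ≐ (C Δ) n'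
  Δ-cong {B} {C} B≐C Y = mk⇔ to from
    where
    to : (B Δ) n' Y → (C Δ) n' Y
    to (inj₁ a) = inj₁ a
    to (inj₂ (Z , Z∈B , e)) = inj₂ (Z , Equivalence.to (B≐C Z) Z∈B , e)
    from : (C Δ) n' Y → (B Δ) n' Y
    from (inj₁ a) = inj₁ a
    from (inj₂ (Z , Z∈C , e)) = inj₂ (Z , Equivalence.from (B≐C Z) Z∈C , e)

  Δ-swap : ∀ {B B' : Coll n} {U V} → SwapAt U V B B' → SwapAt (lift V) (lift U) ((B Δ) n') ((B' Δ) n')
  Δ-swap {B} {B'} {U} {V} (one , swap) = one′ one , λ Y → at-V Y , at-U Y , elsewhere Y
    where
    one′ : ExactlyOne (B U) (B V) → ExactlyOne ((B Δ) n' (lift V)) ((B Δ) n' (lift U))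
    one′ (inj₁ (U∈ , V∉)) = inj₂ ((λ x → V∉ (Equivalence.to (Δ-lift B V) x)) , Equivalence.from (Δ-lift B U) U∈)
    one′ (inj₂ (U∉ , V∈)) = inj₁ (Equivalence.from (Δ-lift B V) V∈ , (λ x → U∉ (Equivalence.to (Δ-lift B U) x)))
    at-V : ∀ Y → Y ≡ lift V → (B' Δ) n' Y ⇔ (B Δ) n' (lift U)
    at-V Y refl = ⇔.trans (Δ-lift B' V) (⇔.trans (proj₁ (proj₂ (swap V)) refl) (⇔.sym (Δ-lift B U)))
    at-U : ∀ Y → Y ≡ lift U → (B' Δ) n' Y ⇔ (B Δ) n' (lift V)
    at-U Y refl = ⇔.trans (Δ-lift B' U) (⇔.trans (proj₁ (swap U) refl) (⇔.sym (Δ-lift B V)))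
    elsewhere : ∀ Y → Y ≢ lift V → Y ≢ lift U → (B' Δ) n' Y ⇔ (B Δ) n' Y
    elsewhere Y Y≢V Y≢U = mk⇔ forward backward
      where
      unswapped : ∀ {Z} → Y ≡ lift Z → B' Z ⇔ B Z
      unswapped {Z} e = proj₂ (proj₂ (swap Z)) (λ Z≡U → Y≢U (trans e (cong lift Z≡U))) (λ Z≡V → Y≢V (trans e (cong lift Z≡V)))
      forward : (B' Δ) n' Y → (B Δ) n' Y
      forward (inj₁ a) = inj₁ a
      forward (inj₂ (Z , Z∈ , e)) = inj₂ (Z , Equivalence.to (unswapped e) Z∈ , e)
      backward : (B Δ) n' Y → (B' Δ) n' Y
      backward (inj₁ a) = inj₁ a
      backward (inj₂ (Z , Z∈ , e)) = inj₂ (Z , Equivalence.from (unswapped e) Z∈ , e)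

  -- With l = n' + |X| + 1 (0-based) and X⁺ = X ∪ tail (X ∪ {a, b}), the tail of X ∪ {a} is
  -- {l} ∪ tail (X ∪ {a, b}); hence (X ∪ {a, b})^Δ = X⁺ ∪ {a, b} and (X ∪ {a})^Δ = X⁺ ∪ {a, l}.
  module LiftedFlip (X : Subset n) (x+2≤n : ∣ X ∣ + 2 ≤ n) where

    open CommutativeMonoidSolver (∪-commutativeMonoid N) using (solve; _⊕_; _⊜_)

    x : ℕ
    x = ∣ X ∣

    T : Subset N
    T = block N (n' + (x + 2)) (n ∸ (x + 2))

    X⁺ : Subset N
    X⁺ = pad X ∪ T

    l₀ : ℕ
    l₀ = n' + (x + 1)

    l<N : l₀ < N
    l<N = ≤-trans (≤-reflexive (shuffle n' x)) (≤-trans (+-monoʳ-≤ n' x+2≤n) (≤-reflexive (+-comm n' n)))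
      where
      shuffle : ∀ n' x → suc (n' + (x + 1)) ≡ n' + (x + 2)
      shuffle = solve-∀

    l : Fin N
    l = F.fromℕ< l<N

    ↑-mono : ∀ {a b : Fin n} → toℕ a < toℕ b → (a ↑ˡ n') F.< (b ↑ˡ n')
    ↑-mono {a} {b} = subst₂ _<_ (sym (toℕ-↑ˡ a n')) (sym (toℕ-↑ˡ b n'))

    ↑<l : ∀ (a : Fin n) → (a ↑ˡ n') F.< l
    ↑<l a = subst₂ _<_ (sym (toℕ-↑ˡ a n')) (sym (toℕ-fromℕ< l<N)) (<-≤-trans (toℕ<n a) (≤-trans n≤n' (m≤m+n n' (x + 1))))

    ↑∉X⁺ : ∀ a → a ∉ X → (a ↑ˡ n') ∉ X⁺
    ↑∉X⁺ a a∉X = bit-false⇒∉ (a ↑ˡ n') (subst (λ z → bit X⁺ z ≡ false) (sym (toℕ-↑ˡ a n'))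
      (bit-∪-false (pad X) T (toℕ a) (trans (bit-pad n' X (toℕ a)) (∉⇒bit-false X a a∉X))
        (bit-block-below N _ _ (toℕ a) (<-≤-trans (toℕ<n a) (≤-trans n≤n' (m≤m+n n' (x + 2)))))))

    l∉X⁺ : l ∉ X⁺
    l∉X⁺ = fromℕ<-∉ l₀ l<N (bit-∪-false (pad X) T l₀ (trans (bit-pad n' X l₀) (bit-beyond X l₀ (≤-trans n≤n' (m≤m+n n' (x + 1)))))
                                                    (bit-block-below N _ _ l₀ (+-monoʳ-< n' (+-monoʳ-< x (n<1+n 1)))))

    ∣X⁺∣+2≡n : ∣ X⁺ ∣ + 2 ≡ n
    ∣X⁺∣+2≡n = begin
      ∣ X⁺ ∣ + 2           ≡⟨ cong (_+ 2) (∣∪∣-disjoint (pad X) T disjoint) ⟩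
      ∣ pad X ∣ + ∣ T ∣ + 2 ≡⟨ cong (λ z → z + 2) (cong₂ _+_ (∣pad∣ n' X) (∣block∣ N _ d T-end)) ⟩
      x + d + 2           ≡⟨ shuffle x d ⟩
      d + (x + 2)         ≡⟨ m∸n+n≡m x+2≤n ⟩
      n                   ∎
      where
      open ≡-Reasoning
      d : ℕ
      d = n ∸ (x + 2)
      T-end : n' + (x + 2) + d ≤ N
      T-end = ≤-reflexive (trans (+-assoc n' (x + 2) d) (trans (cong (n' +_) (trans (+-comm (x + 2) d) (m∸n+n≡m x+2≤n))) (+-comm n' n)))
      shuffle : ∀ x d → x + d + 2 ≡ d + (x + 2)
      shuffle = solve-∀
      disjoint : Disjoint (pad X) T
      disjoint y with n' + (x + 2) ≤? y
      ... | no y<T = trans (cong (bit (pad X) y ∧_) (bit-block-below N _ d y (≰⇒> y<T))) (∧-zeroʳ _)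
      ... | yes T≤y = cong (_∧ bit T y) (trans (bit-pad n' X y) (bit-beyond X y (≤-trans n≤n' (≤-trans (m≤m+n n' (x + 2)) T≤y))))

    pad-pair : ∀ a b → pad (X ∪ ⁅ a ⁆ ∪ ⁅ b ⁆) ≡ pad X ∪ ⁅ a ↑ˡ n' ⁆ ∪ ⁅ b ↑ˡ n' ⁆
    pad-pair a b = trans (∪-pad n' X _) (cong (pad X ∪_) (trans (∪-pad n' ⁅ a ⁆ ⁅ b ⁆) (cong₂ _∪_ (⁅⁆-pad n' a) (⁅⁆-pad n' b))))

    lift-pair : ∀ a b → a ∉ X → b ∉ X → toℕ a ≢ toℕ b → lift (X ∪ ⁅ a ⁆ ∪ ⁅ b ⁆) ≡ X⁺ ∪ ⁅ a ↑ˡ n' ⁆ ∪ ⁅ b ↑ˡ n' ⁆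
    lift-pair a b a∉X b∉X a≢b = trans (lift-split (X ∪ ⁅ a ⁆ ∪ ⁅ b ⁆))
      (trans (cong₂ _∪_ (pad-pair a b) (cong (λ c → block N (n' + c) (n ∸ c)) (∣∪⁅⁆∪⁅⁆∣ X a b a∉X b∉X a≢b)))
        (solve 4 (λ e p q t → (e ⊕ (p ⊕ q)) ⊕ t ⊜ (e ⊕ t) ⊕ (p ⊕ q)) refl (pad X) ⁅ a ↑ˡ n' ⁆ ⁅ b ↑ˡ n' ⁆ T))

    tail-single : block N (n' + (x + 1)) (n ∸ (x + 1)) ≡ ⁅ l ⁆ ∪ T
    tail-single =
      trans (cong (block N l₀) (trans (+-∸-assoc 1 (subst (_≤ n) (+-suc x 1) x+2≤n)) (cong (λ z → suc (n ∸ z)) (sym (+-suc x 1)))))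
        (trans (sym (block-adjacent (shuffle n' x) refl)) (cong (_∪ T) (sym (⁅fromℕ<⁆≡block l₀ l<N))))
      where
      shuffle : ∀ n' x → n' + (x + 1) + 1 ≡ n' + (x + 2)
      shuffle = solve-∀

    lift-single : ∀ a → a ∉ X → lift (X ∪ ⁅ a ⁆) ≡ X⁺ ∪ ⁅ a ↑ˡ n' ⁆ ∪ ⁅ l ⁆
    lift-single a a∉X = trans (lift-split (X ∪ ⁅ a ⁆))
      (trans (cong₂ _∪_ (trans (∪-pad n' X ⁅ a ⁆) (cong (pad X ∪_) (⁅⁆-pad n' a)))
                        (trans (cong (λ c → block N (n' + c) (n ∸ c)) (∣∪⁅⁆∣ X a (∉⇒bit-false X a a∉X))) tail-single))
        (solve 4 (λ e p l t → (e ⊕ p) ⊕ (l ⊕ t) ⊜ (e ⊕ t) ⊕ (p ⊕ l)) refl (pad X) ⁅ a ↑ˡ n' ⁆ ⁅ l ⁆ T))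

  Δ-flip : ∀ {B B' : Coll n} → Flip B B' → Flip4 n ((B Δ) n') ((B' Δ) n')
  Δ-flip {B} {B'} (i , j , k , X , i<j , j<k , i∉X , j∉X , k∉X , Xij∈ , Xk∈ , Xi∈ , Xjk∈ , swap) =
    i ↑ˡ n' , j ↑ˡ n' , k ↑ˡ n' , l , X⁺ , ↑-mono i<j , ↑-mono j<k , ↑<l k ,
    ↑∉X⁺ i i∉X , ↑∉X⁺ j j∉X , ↑∉X⁺ k k∉X , l∉X⁺ , ∣X⁺∣+2≡n ,
    lifted (lift-pair i j i∉X j∉X (<⇒≢ i<j)) Xij∈ , lifted (lift-single k k∉X) Xk∈ ,
    lifted (lift-single i i∉X) Xi∈ , lifted (lift-pair j k j∉X k∉X (<⇒≢ j<k)) Xjk∈ ,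
    subst₂ (λ U V → SwapAt U V ((B Δ) n') ((B' Δ) n'))
      (lift-pair i k i∉X k∉X (<⇒≢ (<-trans i<j j<k))) (lift-single j j∉X) (Δ-swap swap)
    where
    open LiftedFlip X (≤-trans (≤-reflexive (sym (∣∪⁅⁆∪⁅⁆∣ X i j i∉X j∉X (<⇒≢ i<j)))) (∣p∣≤n (X ∪ ⁅ i ⁆ ∪ ⁅ j ⁆)))
    lifted : ∀ {Y Z} → lift Y ≡ Z → B Y → (B Δ) n' Z
    lifted e Y∈ = subst ((B Δ) n') e (inj₂ (_ , Y∈ , refl))

  open TwoBlocks N n using (twoBlock; Fits; Layout; rightmost; twoBlock-end)

  lift-full : lift (block n 0 n) ≡ block N 0 n
  lift-full = trans (lift-split (block n 0 n))
    (trans (cong₂ _∪_ (block-pad n n' 0 n ≤-refl)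
                      (trans (cong (λ c → block N (n' + c) (n ∸ c)) (∣block∣ n 0 n ≤-refl))
                             (trans (cong (block N (n' + n)) (n∸n≡0 n)) (block-empty N _))))
           (∪-identityʳ _))

  lift-∅ : lift S.⊥ ≡ block N (n' + 0) n
  lift-∅ = trans (lift-split S.⊥) (trans (cong₂ _∪_ (⊥-pad n n') (cong (λ c → block N (n' + c) (n ∸ c)) (∣⊥∣≡0 n))) (∪-identityˡ _))

  lift-block : ∀ P s → P + s ≤ n → lift (block n P s) ≡ block N P s ∪ block N (n' + s) (n ∸ s)
  lift-block P s P+s≤n = trans (lift-split (block n P s))
    (cong₂ _∪_ (block-pad n n' P s P+s≤n) (cong (λ c → block N (n' + c) (n ∸ c)) (∣block∣ n P s P+s≤n)))

  rightmost-end : ∀ {s g P} → Fits s g P → P ≡ rightmost s g → P + n + g ≡ N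
  rightmost-end {g = g} {P} (_ , _ , _ , fits) P≡ =
    trans (+-assoc P n g) (trans (cong (_+ (n + g)) P≡) (m∸n+n≡m (≤-trans (m≤n+m (n + g) P) (≤-trans (≤-reflexive (sym (+-assoc P n g))) fits))))

  -- A two-block set at its rightmost position is X^Δ when its left block lies in [n], and in 𝓐 otherwise.
  rightmost⊆𝓘Δ : 1 ≤ n → ∀ Y → Layout rightmost Y → (𝓘 n Δ) n' Y
  rightmost⊆𝓘Δ 1≤n Y (inj₁ (zero , _ , e)) =
    inj₂ (block n 0 n , inj₂ (1 , n , ≤-refl , 1≤n , ≤-refl , sym (⟦⟧≡block n 0 n)) , trans e (sym lift-full))
  rightmost⊆𝓘Δ 1≤n Y (inj₁ (suc b , a+n≤N , e)) with suc b + n ≟ N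
  ... | yes a+n≡N = inj₂ (S.⊥ , inj₁ refl , trans e (trans (cong (λ z → block N z n) a≡) (sym lift-∅)))
    where
    a≡ : suc b ≡ n' + 0
    a≡ = +-cancelʳ-≡ n (suc b) (n' + 0) (trans a+n≡N (trans (+-comm n n') (cong (_+ n) (sym (+-identityʳ n')))))
  ... | no a+n≢N = inj₁ (inj₁ (suc (suc b) , suc b + n , s≤s z≤n , ≤-trans (≤-reflexive (+-comm 1 (suc b))) (+-monoʳ-≤ (suc b) 1≤n) ,
                               m<n+m n (s≤s z≤n) , ≤∧≢⇒< a+n≤N a+n≢N , trans e (sym (⟦⟧≡block N (suc b) n)) ,
                               trans (cong ∣_∣ e) (∣block∣ N (suc b) n a+n≤N)))
  rightmost⊆𝓘Δ 1≤n Y (inj₂ (s , g , P , v@(1≤s , s<n , 1≤g , _) , e , P≡)) with P + s ≤? n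
  ... | yes P+s≤n = inj₂ (block n P s , inj₂ (suc P , P + s , s≤s z≤n , m<m+n P 1≤s , P+s≤n , sym (⟦⟧≡block n P s)) ,
                         trans e (trans (cong (λ z → block N P s ∪ block N z (n ∸ s)) (trans (shuffle P s g) (cong (_+ s) P+g≡n')))
                                        (sym (lift-block P s P+s≤n))))
    where
    shuffle : ∀ P s g → P + s + g ≡ P + g + s
    shuffle = solve-∀
    P+g≡n' : P + g ≡ n'
    P+g≡n' = +-cancelˡ-≡ n _ _ (trans (shuffle′ n P g) (rightmost-end v P≡))
      where
      shuffle′ : ∀ n P g → n + (P + g) ≡ P + n + g
      shuffle′ = solve-∀
  ... | no P+s≰n = inj₁ (inj₂ (suc P , P + s , suc (P + s + g) , s≤s z≤n , m<m+n P 1≤s , ≰⇒> P+s≰n ,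
                               s≤s (+-monoʳ-≤ (P + s) 1≤g) , r≤N ,
                               trans e (cong₂ _∪_ (sym (⟦⟧≡block N P s)) (sym right≡)) ,
                               trans (cong ∣_∣ e) (trans (∣block∪block∣ N P s (P + s + g) (n ∸ s) (m≤m+n (P + s) g) (≤-reflexive end≡))
                                                        (m+[n∸m]≡n (<⇒≤ s<n)))))
    where
    end≡ : P + s + g + (n ∸ s) ≡ N
    end≡ = trans (twoBlock-end s g P (<⇒≤ s<n)) (rightmost-end v P≡)
    r≤N : suc (P + s + g) ≤ N
    r≤N = ≤-trans (+-monoˡ-< g (+-monoʳ-< P s<n)) (≤-reflexive (rightmost-end v P≡))
    right≡ : ⟦_‥_⟧ {N} (suc (P + s + g)) N ≡ block N (P + s + g) (n ∸ s)
    right≡ = trans (cong (⟦_‥_⟧ (suc (P + s + g))) (sym end≡)) (⟦⟧≡block N (P + s + g) (n ∸ s))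

  𝓐⊆rightmost : ∀ Y → 𝓐 n n' Y → Layout rightmost Y
  𝓐⊆rightmost Y (inj₁ (suc a , q , _ , a<q , _ , q<N , e , ∣Y∣≡n)) with m≤n⇒∃[o]m+o≡n (≤-trans (n≤1+n a) a<q)
  ... | l , refl = inj₁ (a , subst (λ z → a + z ≤ N) l≡n (<⇒≤ q<N) , subst (λ z → Y ≡ block N a z) l≡n Y≡)
    where
    Y≡ : Y ≡ block N a l
    Y≡ = trans e (⟦⟧≡block N a l)
    l≡n : l ≡ n
    l≡n = trans (sym (∣block∣ N a l (<⇒≤ q<N))) (trans (cong ∣_∣ (sym Y≡)) ∣Y∣≡n)
  𝓐⊆rightmost Y (inj₂ (suc P , q , suc r , _ , P<q , _ , q+1<r , r≤N , e , ∣Y∣≡n))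
    with m≤n⇒∃[o]m+o≡n (≤-trans (n≤1+n P) P<q)
  ... | s , refl with m≤n⇒∃[o]m+o≡n (≤-trans (n≤1+n (P + s)) (≤-pred (subst (_< suc r) (+-comm (P + s) 1) q+1<r)))
  ... | g , refl = inj₂ (s , g , P , (1≤s , s<n , 1≤g , ≤-reflexive end≡) , Y≡twoBlock , sym P≡)
    where
    l = N ∸ (P + s + g)
    right-end : P + s + g + l ≡ N
    right-end = m+[n∸m]≡n (<⇒≤ r≤N)
    Y≡ : Y ≡ block N P s ∪ block N (P + s + g) l
    Y≡ = trans e (cong₂ _∪_ (⟦⟧≡block N P s) (⟦⟧≡block′ N (suc (P + s + g)) N (s≤s z≤n) (≤-trans r≤N (n≤1+n _))))
    s+l≡n : s + l ≡ n
    s+l≡n = trans (sym (∣block∪block∣ N P s (P + s + g) l (m≤m+n (P + s) g) (≤-reflexive right-end))) (trans (cong ∣_∣ (sym Y≡)) ∣Y∣≡n)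
    1≤s : 1 ≤ s
    1≤s = +-cancelˡ-≤ P 1 s (subst (_≤ P + s) (+-comm 1 P) P<q)
    1≤g : 1 ≤ g
    1≤g = +-cancelˡ-≤ (P + s) 1 g (subst (_≤ P + s + g) (+-comm 1 (P + s)) (≤-pred (subst (_< suc (P + s + g)) (+-comm (P + s) 1) q+1<r)))
    s<n : s < n
    s<n = subst (s <_) s+l≡n (m<m+n s (m<n⇒0<n∸m r≤N))
    end≡ : P + n + g ≡ N
    end≡ = trans (cong (λ z → P + z + g) (sym s+l≡n)) (trans (shuffle P s l g) right-end)
      where
      shuffle : ∀ P s l g → P + (s + l) + g ≡ P + s + g + l
      shuffle = solve-∀
    Y≡twoBlock : Y ≡ twoBlock s g P
    Y≡twoBlock = trans Y≡ (cong (λ z → block N P s ∪ block N (P + s + g) z) (trans (sym (m+n∸m≡n s l)) (cong (_∸ s) s+l≡n)))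
    P≡ : N ∸ (n + g) ≡ P
    P≡ = trans (cong (_∸ (n + g)) (trans (sym end≡) (+-assoc P n g))) (m+n∸n≡m P (n + g))
  lift-𝓘⊆rightmost : ∀ X → 𝓘 n X → Layout rightmost (lift X)
  lift-𝓘⊆rightmost X (inj₁ refl) =
    inj₁ (n' + 0 , ≤-reflexive (trans (cong (_+ n) (+-identityʳ n')) (+-comm n' n)) , lift-∅)
  lift-𝓘⊆rightmost X (inj₂ (suc P , q , _ , P<q , q≤n , refl)) with m≤n⇒∃[o]m+o≡n (≤-trans (n≤1+n P) P<q)
  ... | s , refl with m≤n⇒m<n∨m≡n (m+n≤o⇒n≤o P q≤n)
  ... | inj₁ s<n = inj₂ (s , n' ∸ P , P , (1≤s , s<n , 1≤g , ≤-reflexive end≡) , lift≡twoBlock , sym P≡)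
    where
    P≤n' : P ≤ n'
    P≤n' = ≤-trans (m≤m+n P s) (≤-trans q≤n n≤n')
    1≤s : 1 ≤ s
    1≤s = +-cancelˡ-≤ P 1 s (subst (_≤ P + s) (+-comm 1 P) P<q)
    1≤g : 1 ≤ n' ∸ P
    1≤g = m<n⇒0<n∸m (<-≤-trans (m<m+n P 1≤s) (≤-trans q≤n n≤n'))
    end≡ : P + n + (n' ∸ P) ≡ N
    end≡ = trans (shuffle P n (n' ∸ P)) (cong (n +_) (m+[n∸m]≡n P≤n'))
      where
      shuffle : ∀ P n g → P + n + g ≡ n + (P + g)
      shuffle = solve-∀
    lift≡twoBlock : lift ⟦ suc P ‥ P + s ⟧ ≡ twoBlock s (n' ∸ P) P
    lift≡twoBlock = trans (cong lift (⟦⟧≡block n P s)) (trans (lift-block P s q≤n)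
      (cong (λ z → block N P s ∪ block N z (n ∸ s)) (trans (+-comm n' s) (trans (cong (s +_) (sym (m+[n∸m]≡n P≤n'))) (shuffle P s (n' ∸ P))))))
      where
      shuffle : ∀ P s g → s + (P + g) ≡ P + s + g
      shuffle = solve-∀
    P≡ : N ∸ (n + (n' ∸ P)) ≡ P
    P≡ = trans (cong (_∸ (n + (n' ∸ P))) (trans (sym end≡) (+-assoc P n (n' ∸ P)))) (m+n∸n≡m P (n + (n' ∸ P)))
  ... | inj₂ refl = inj₁ (0 , m≤m+n s n' ,
    trans (cong lift (⟦⟧≡block s P s)) (trans (lift-block P s q≤n)
      (trans (cong₂ _∪_ (cong (λ z → block N z s) P≡0) (trans (cong (block N (n' + s)) (n∸n≡0 s)) (block-empty N _))) (∪-identityʳ _))))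
    where
    P≡0 : P ≡ 0
    P≡0 = n≤0⇒n≡0 (+-cancelʳ-≤ s P 0 q≤n)

  𝓘Δ⊆rightmost : ∀ Y → (𝓘 n Δ) n' Y → Layout rightmost Y
  𝓘Δ⊆rightmost Y (inj₁ Y∈𝓐) = 𝓐⊆rightmost Y Y∈𝓐
  𝓘Δ⊆rightmost Y (inj₂ (X , X∈𝓘 , refl)) = lift-𝓘⊆rightmost X X∈𝓘

  Layout-rightmost≐𝓘Δ : 1 ≤ n → Layout rightmost ≐ (𝓘 n Δ) n'
  Layout-rightmost≐𝓘Δ 1≤n Y = mk⇔ (rightmost⊆𝓘Δ 1≤n Y) (𝓘Δ⊆rightmost Y)

  Δ-reach : ∀ {C} → SemiNormal n C → Reach (Flip4 n) ((𝓘 n Δ) n') ((C Δ) n')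
  Δ-reach (base C≐𝓘) = base (Δ-cong C≐𝓘)
  Δ-reach (step r f) = step (Δ-reach r) (Δ-flip f)

proposition11p3 : (n n' : ℕ) → 2 ≤ n → n ≤ n' → (B : Coll n) →
    SemiNormal n B → InB (n + n') n ((B Δ) n')
proposition11p3 n n' 2≤n n≤n' B B-semiNormal =
  Reach-trans (Reach-≐ (𝓘𝓢-reaches-rightmost 1≤n) (Layout-rightmost≐𝓘Δ 1≤n)) (Δ-reach B-semiNormal)
  where
  open TwoBlocks (n + n') n using (𝓘𝓢-reaches-rightmost)
  open Embedding n n' n≤n' using (Layout-rightmost≐𝓘Δ; Δ-reach)
  1≤n : 1 ≤ n
  1≤n = ≤-trans (s≤s z≤n) 2≤n
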